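{- For all $\sigma_1\in BP_1(n)$, one has $\beta(\sigma_1)\in BP_2(n)$.
   Context: $\mathfrak{S}_n$ is the symmetric group on $[n]$; a cycle word $(a_1\cdots a_m)$ denotes $a_1\mapsto a_2\mapsto\cdots\mapsto a_m\mapsto a_1$. $BP_1(n)$ is the set of permutations obtained from a set partition of $[n]$ by writing each block in decreasing order and making it a cycle. The map $\beta$: write $\sigma_1=C_1\cdots C_k$ with cycles ordered by increasing minima, each written in decreasing order starting at its maximum; for $i=k,\ldots,2$, if $i$ is not in the current word of $C_i$, remove that word and insert it contiguously right after the letter $i$ in the cycle word currently containing $i$; $\beta(\sigma_1)$ is the resulting permutation. For $\sigma\in\mathfrak{S}_n$ and $i\in[n]$, $\mathrm{inom}(i)=\sigma^{ -t}(i)$ where $t\ge1$ is smallest with $\sigma^{ -t}(i)\le i$; the inom code of $\sigma$ is $f_1\cdots f_n$ with $f_i=\mathrm{inom}(i)$ (equivalently the unique subexceedant function with $\sigma=(n\ f_n)\cdots(1\ f_1)$, leftmost transposition acting first). $BP_2(n)$ is the set of $\sigma\in\mathfrak{S}_n$ whose inom code has $\{f_1,\dots,f_i\}$ an integer interval for every $i\in[n]$. -}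

module Defs where

open import Data.Bool using (Bool; true; false; if_then_else_)
open import Data.Nat using (ℕ; zero; suc; _∸_; _⊔_; _≡ᵇ_; _≤ᵇ_; _<_)
open import Data.Nat.Properties using (_<?_)
open import Data.Fin as F using (Fin; toℕ; fromℕ<)
open import Data.Fin.Permutation using (Permutation′; _⟨$⟩ʳ_; _⟨$⟩ˡ_)
open import Data.List using (List; []; _∷_; _++_; map; foldr; length; upTo; concat)
open import Data.Bool.ListAction using (any; all)
open import Data.List.Relation.Unary.All using (All)
open import Data.List.Relation.Unary.Linked using (Linked)
open import Data.List.Relation.Binary.Permutation.Propositional using (_↭_)
open import Data.Maybe using (Maybe; just; nothing)
open import Data.Product using (Σ; _×_; ∃)
open import Relation.Binary.PropositionalEquality using (_≡_; _≢_)
open import Relation.Nullary using (yes; no)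

-- Conventions.  The letters 1,…,n of the paper are encoded as the
-- natural numbers 0,…,n-1 (resp. as Fin n).  A "cycle word" is a
-- List ℕ; the word a₁ ⋯ aₘ denotes a₁ ↦ a₂ ↦ ⋯ ↦ aₘ ↦ a₁.

nextAux : ℕ → List ℕ → ℕ → Maybe ℕ
nextAux first []           x = nothing
nextAux first (a ∷ [])     x = if a ≡ᵇ x then just first else nothing
nextAux first (a ∷ b ∷ rs) x = if a ≡ᵇ x then just b else nextAux first (b ∷ rs) x

nextIn : List ℕ → ℕ → Maybe ℕ
nextIn []       x = nothing
nextIn (a ∷ as) x = nextAux a (a ∷ as) x

wordsPerm : List (List ℕ) → ℕ → ℕ
wordsPerm []       x = x
wordsPerm (w ∷ ws) x with nextIn w x
... | just y  = y
... | nothing = wordsPerm ws x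

IsDecSetPartition : ℕ → List (List ℕ) → Set
IsDecSetPartition n P =
  All (λ B → B ≢ []) P × All (Linked (λ a b → b < a)) P × (concat P ↭ upTo n)

BP₁ : (n : ℕ) → Permutation′ n → Set
BP₁ n σ = Σ (List (List ℕ)) λ P → IsDecSetPartition n P ×
            (∀ (i : Fin n) → toℕ (σ ⟨$⟩ʳ i) ≡ wordsPerm P (toℕ i))

-- σ as a function on ℕ (identity outside [0,n))
fun : {n : ℕ} → Permutation′ n → ℕ → ℕ
fun {n} σ x with x <? n
... | yes x<n = toℕ (σ ⟨$⟩ʳ fromℕ< x<n)
... | no  _   = x

orbitFrom : ℕ → (ℕ → ℕ) → ℕ → ℕ → List ℕ
orbitFrom zero     g x y = []
orbitFrom (suc k) g x y = if y ≡ᵇ x then [] else y ∷ orbitFrom k g x (g y)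

orbit : ℕ → (ℕ → ℕ) → ℕ → List ℕ
orbit n g x = x ∷ orbitFrom n g x (g x)

maxList : List ℕ → ℕ
maxList = foldr _⊔_ 0

filterᵇ : (ℕ → Bool) → List ℕ → List ℕ
filterᵇ p []       = []
filterᵇ p (x ∷ xs) = if p x then x ∷ filterᵇ p xs else filterᵇ p xs

cycleMinima : {n : ℕ} → Permutation′ n → List ℕ
cycleMinima {n} σ = filterᵇ (λ m → all (λ y → m ≤ᵇ y) (orbit n (fun σ) m)) (upTo n)

-- the cycle words C₁ ⋯ C_k of σ: ordered by increasing minima, each
-- written starting at its maximum (following σ)
cycleWords : {n : ℕ} → Permutation′ n → List (List ℕ)
cycleWords {n} σ =
  map (λ m → orbit n (fun σ) (maxList (orbit n (fun σ) m))) (cycleMinima σ)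

-- i-th entry of a list of words ([] if out of range)
slot : List (List ℕ) → ℕ → List ℕ
slot []       _       = []
slot (w ∷ ws) zero    = w
slot (w ∷ ws) (suc i) = slot ws i

clearSlot : List (List ℕ) → ℕ → List (List ℕ)
clearSlot []       _       = []
clearSlot (w ∷ ws) zero    = [] ∷ ws
clearSlot (w ∷ ws) (suc i) = w ∷ clearSlot ws i

insertAfter : ℕ → List ℕ → List ℕ → List ℕ
insertAfter i u []       = []
insertAfter i u (a ∷ as) =
  if a ≡ᵇ i then a ∷ (u ++ insertAfter i u as) else a ∷ insertAfter i u as

-- one step of β for (0-based) index i, i.e. for the paper's index i+1:
-- the current word of C_{i+1} is the (i)-th slot; letter i is the
-- paper's letter i+1.  A removed word leaves an empty slot.
βstep : ℕ → List (List ℕ) → List (List ℕ)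
βstep i ws =
  if any (λ a → a ≡ᵇ i) (slot ws i)
  then ws
  else map (insertAfter i (slot ws i)) (clearSlot ws i)

βloop : ℕ → List (List ℕ) → List (List ℕ)
βloop zero    ws = ws
βloop (suc j) ws = βloop j (βstep (suc j) ws)

-- β(σ₁) as a function on letters: paper indices i = k,…,2 are the
-- 0-based indices k-1,…,1
β : {n : ℕ} → Permutation′ n → ℕ → ℕ
β σ = wordsPerm (βloop (length (cycleWords σ) ∸ 1) (cycleWords σ))

invPow : {n : ℕ} → Permutation′ n → ℕ → Fin n → Fin n
invPow σ zero    i = i
invPow σ (suc t) i = σ ⟨$⟩ˡ (invPow σ t i)

IsInom : {n : ℕ} → Permutation′ n → Fin n → Fin n → Set
IsInom σ i j = Σ ℕ λ t → (1 Data.Nat.≤ t) × (invPow σ t i ≡ j) × (j F.≤ i) ×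
                 (∀ s → 1 Data.Nat.≤ s → s < t → i F.< invPow σ s i)

-- {f₁,…,f_i} is an integer interval for every i
PrefixIntervals : {n : ℕ} → (Fin n → Fin n) → Set
PrefixIntervals {n} f = ∀ (i a b m : Fin n) → a F.≤ i → b F.≤ i →
  f a F.≤ m → m F.≤ f b → Σ (Fin n) λ c → (c F.≤ i) × (f c ≡ m)

BP₂cond : {n : ℕ} → Permutation′ n → Set
BP₂cond {n} σ = Σ (Fin n → Fin n) λ f → (∀ i → IsInom σ i (f i)) × PrefixIntervals f

InBP₂ : (n : ℕ) → (ℕ → ℕ) → Set
InBP₂ n g = Σ (Permutation′ n) λ τ →
  (∀ (i : Fin n) → toℕ (τ ⟨$⟩ʳ i) ≡ g (toℕ i)) × BP₂cond τ

-- Index the cycles C₀, C₁, … of σ₁ by increasing minima (letters and indices both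
-- start at 0) and let r x be the index of the cycle containing x; each Cₐ is a
-- block of the partition, written decreasingly from its maximum to its minimum,
-- so r x ≤ x.  We show that r is the inom code of β(σ₁).
--
-- Throughout β the word list keeps every letter once, and word a keeps the
-- following shape: its letters are ≥ a, it ends with a if it contains a, and the
-- nearest letter ≤ x to the left of any x in it is r x (or, if there is none,
-- r x = a).  A step moves the word u of index i, all of whose letters exceed i,
-- right behind the letter i; no letter outside u is labelled i, so the labels
-- survive.  At the end every word contains and ends with its index a, so reading
-- the cycle of β(σ₁) backwards from x and wrapping around past the first letter
-- to the final a, the first letter ≤ x met is r x, i.e. inom(x) = r x.  Finally
-- {r 0, …, r i} is an interval: it contains 0, and any m ≤ r b with b ≤ i is the
-- label of the m-th cycle minimum, which is at most the (r b)-th one, hence ≤ b.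

module Submission where

open import Data.Bool using (Bool; true; false; if_then_else_; T)
open import Data.Bool.ListAction using (any; all)
open import Data.Empty using (⊥; ⊥-elim)
open import Data.Fin using (Fin; toℕ; fromℕ<)
open import Data.Fin.Properties using (toℕ-fromℕ<; toℕ<n; toℕ-injective)
open import Data.Fin.Permutation using (Permutation′; _⟨$⟩ʳ_; _⟨$⟩ˡ_; permutation)
open import Data.List
  using (List; []; _∷_; _++_; _ʳ++_; map; length; upTo; concat; reverse)
open import Data.List.Properties
  using (++-assoc; reverse-++; unfold-reverse; ʳ++-defn; reverse-involutive; map-++; length-++; length-map;
         length-upTo; upTo-∷ʳ; ∷ʳ-injective; ∷-injectiveʳ)
open import Data.List.Relation.Unary.All as All using (All; []; _∷_)
import Data.List.Relation.Unary.All.Properties as All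
open import Data.List.Relation.Unary.AllPairs using (AllPairs; []; _∷_)
import Data.List.Relation.Unary.AllPairs.Properties as AllPairs
open import Data.List.Relation.Unary.Linked as Linked using (Linked; []; _∷_)
open import Data.List.Relation.Unary.Linked.Properties using (Linked⇒AllPairs)
open import Data.List.Relation.Binary.Permutation.Propositional as ↭ using (_↭_)
open import Data.List.Relation.Binary.Permutation.Propositional.Properties using (↭-length)
open import Data.Nat
open import Data.Nat.GeneralisedArithmetic using (fold; iterate; iterate-is-fold)
open import Data.Nat.Properties
open import Algebra.Properties.CommutativeSemigroup +-commutativeSemigroup using (x∙yz≈y∙xz; interchange)
open import Data.Maybe using (just; nothing)
open import Data.Product using (Σ; _×_; _,_; proj₁; proj₂; map₁; map₂)
open import Data.Sum using (_⊎_; inj₁; inj₂; [_,_]′)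
open import Data.Unit using (⊤; tt)
open import Function using (_∘_)
open import Relation.Binary.Definitions using (tri<; tri≈; tri>)
open import Relation.Binary.PropositionalEquality
open import Relation.Nullary using (¬_; yes; no)

open import Defs

≡ᵇ-refl : ∀ m → (m ≡ᵇ m) ≡ true
≡ᵇ-refl zero    = refl
≡ᵇ-refl (suc m) = ≡ᵇ-refl m

≡ᵇ-true⇒≡ : ∀ m n → (m ≡ᵇ n) ≡ true → m ≡ n
≡ᵇ-true⇒≡ m n e = ≡ᵇ⇒≡ m n (subst T (sym e) tt)

≢⇒≡ᵇ-false : ∀ m n → m ≢ n → (m ≡ᵇ n) ≡ false
≢⇒≡ᵇ-false m n m≢n with m ≡ᵇ n in e
... | true  = ⊥-elim (m≢n (≡ᵇ-true⇒≡ m n e))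
... | false = refl

≡ᵇ-false⇒≢ : ∀ m n → (m ≡ᵇ n) ≡ false → m ≢ n
≡ᵇ-false⇒≢ m .m e refl with () ← trans (sym (≡ᵇ-refl m)) e

≤⇒≤ᵇ-true : ∀ m n → m ≤ n → (m ≤ᵇ n) ≡ true
≤⇒≤ᵇ-true m n m≤n with m ≤ᵇ n in e
... | true  = refl
... | false = ⊥-elim (subst T e (≤⇒≤ᵇ m≤n))

≤ᵇ-true⇒≤ : ∀ m n → (m ≤ᵇ n) ≡ true → m ≤ n
≤ᵇ-true⇒≤ m n e = ≤ᵇ⇒≤ m n (subst T (sym e) tt)

>⇒≤ᵇ-false : ∀ m n → n < m → (m ≤ᵇ n) ≡ false
>⇒≤ᵇ-false m n n<m with m ≤ᵇ n in e
... | true  = ⊥-elim (<⇒≱ n<m (≤ᵇ-true⇒≤ m n e))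
... | false = refl

≤ᵇ-false⇒> : ∀ m n → (m ≤ᵇ n) ≡ false → n < m
≤ᵇ-false⇒> m n e = ≰⇒> λ m≤n → ⊥-elim (subst T e (≤⇒≤ᵇ m≤n))

-- Occurrence counts

occ : ℕ → List ℕ → ℕ
occ x []       = 0
occ x (y ∷ ys) = if y ≡ᵇ x then suc (occ x ys) else occ x ys

occ-here : ∀ x ys → occ x (x ∷ ys) ≡ suc (occ x ys)
occ-here x ys rewrite ≡ᵇ-refl x = refl

occ-here-pos : ∀ x ys → 0 < occ x (x ∷ ys)
occ-here-pos x ys rewrite occ-here x ys = z<s

occ-there : ∀ x y ys → y ≢ x → occ x (y ∷ ys) ≡ occ x ys
occ-there x y ys y≢x rewrite ≢⇒≡ᵇ-false y x y≢x = refl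

occ-there-pos : ∀ x y ys → 0 < occ x ys → 0 < occ x (y ∷ ys)
occ-there-pos x y ys p with y ≡ᵇ x
... | true  = z<s
... | false = p

occ-++ : ∀ x xs ys → occ x (xs ++ ys) ≡ occ x xs + occ x ys
occ-++ x []       ys = refl
occ-++ x (y ∷ xs) ys with y ≡ᵇ x
... | true  = cong suc (occ-++ x xs ys)
... | false = occ-++ x xs ys

occ-reverse : ∀ x xs → occ x (reverse xs) ≡ occ x xs
occ-reverse x []       = refl
occ-reverse x (y ∷ xs)
  rewrite unfold-reverse y xs | occ-++ x (reverse xs) (y ∷ []) | occ-reverse x xs with y ≡ᵇ x
... | true  = +-comm (occ x xs) 1
... | false = +-identityʳ (occ x xs)

occ-concat-++ : ∀ x (V W : List (List ℕ)) → occ x (concat (V ++ W)) ≡ occ x (concat V) + occ x (concat W)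
occ-concat-++ x []      W = refl
occ-concat-++ x (v ∷ V) W
  rewrite occ-++ x v (concat (V ++ W)) | occ-++ x v (concat V) | occ-concat-++ x V W =
  sym (+-assoc (occ x v) _ _)

occ-↭ : ∀ x {xs ys} → xs ↭ ys → occ x xs ≡ occ x ys
occ-↭ x ↭.refl = refl
occ-↭ x (↭.prep y p) with y ≡ᵇ x
... | true  = cong suc (occ-↭ x p)
... | false = occ-↭ x p
occ-↭ x (↭.swap y z p) with y ≡ᵇ x | z ≡ᵇ x
... | true  | true  = cong (λ k → suc (suc k)) (occ-↭ x p)
... | true  | false = cong suc (occ-↭ x p)
... | false | true  = cong suc (occ-↭ x p)
... | false | false = occ-↭ x p
occ-↭ x (↭.trans p q) = trans (occ-↭ x p) (occ-↭ x q)

χ : ℕ → ℕ → ℕ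
χ n x = if x <ᵇ n then 1 else 0

χ-< : ∀ {n x} → x < n → χ n x ≡ 1
χ-< {n} {x} x<n with x <ᵇ n in e
... | true  = refl
... | false = ⊥-elim (subst T e (<⇒<ᵇ x<n))

χ-≮ : ∀ {n x} → ¬ x < n → χ n x ≡ 0
χ-≮ {n} {x} x≮n with x <ᵇ n in e
... | true  = ⊥-elim (x≮n (<ᵇ⇒< x n (subst T (sym e) tt)))
... | false = refl

χ-pos⇒< : ∀ {n x} → 0 < χ n x → x < n
χ-pos⇒< {n} {x} p with x <? n
... | yes x<n = x<n
... | no  x≮n = ⊥-elim (<-irrefl (sym (χ-≮ x≮n)) p)

occ-upTo : ∀ x n → occ x (upTo n) ≡ χ n x
occ-upTo x zero    = refl
occ-upTo x (suc n) = begin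
  occ x (upTo (suc n))                ≡⟨ cong (occ x) (sym (upTo-∷ʳ n)) ⟩
  occ x (upTo n ++ n ∷ [])            ≡⟨ occ-++ x (upTo n) (n ∷ []) ⟩
  occ x (upTo n) + occ x (n ∷ [])     ≡⟨ cong (_+ occ x (n ∷ [])) (occ-upTo x n) ⟩
  χ n x + occ x (n ∷ [])              ≡⟨ χ-step ⟩
  χ (suc n) x                         ∎
  where
  open ≡-Reasoning
  χ-step : χ n x + occ x (n ∷ []) ≡ χ (suc n) x
  χ-step with <-cmp x n
  ... | tri< x<n x≢n _ rewrite χ-< x<n | χ-< (m<n⇒m<1+n x<n) | ≢⇒≡ᵇ-false n x (≢-sym x≢n) = refl
  ... | tri≈ x≮n refl _ rewrite χ-≮ x≮n | χ-< (n<1+n x) | ≡ᵇ-refl x = refl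
  ... | tri> x≮n x≢n n<x
    rewrite χ-≮ x≮n | χ-≮ {suc n} (λ x<1+n → <⇒≱ n<x (s≤s⁻¹ x<1+n)) | ≢⇒≡ᵇ-false n x (≢-sym x≢n) = refl

split-at-first : ∀ x xs → 0 < occ x xs →
  Σ (List ℕ) λ p → Σ (List ℕ) λ q → (xs ≡ p ++ x ∷ q) × (occ x p ≡ 0)
split-at-first x (y ∷ xs) pos with y ≡ᵇ x in e
... | true rewrite ≡ᵇ-true⇒≡ y x e = [] , xs , refl , refl
... | false with split-at-first x xs pos
... | p , q , refl , p₀ = y ∷ p , q , refl , trans (occ-there x y p (≡ᵇ-false⇒≢ y x e)) p₀

occ-middle : ∀ x p q → occ x (p ++ x ∷ q) ≡ occ x p + suc (occ x q)
occ-middle x p q rewrite occ-++ x p (x ∷ q) | occ-here x q = refl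

occ-middle-pos : ∀ x p q → 0 < occ x (p ++ x ∷ q)
occ-middle-pos x p q rewrite occ-middle x p q = ≤-trans z<s (m≤n+m (suc (occ x q)) (occ x p))

occ-prefix-zero : ∀ x p q → occ x (p ++ x ∷ q) ≡ 1 → occ x p ≡ 0
occ-prefix-zero x p q once = m+n≡0⇒m≡0 (occ x p) (suc-injective (begin
  suc (occ x p + occ x q)  ≡⟨ sym (+-suc (occ x p) (occ x q)) ⟩
  occ x p + suc (occ x q)  ≡⟨ sym (occ-middle x p q) ⟩
  occ x (p ++ x ∷ q)       ≡⟨ once ⟩
  1                        ∎))
  where open ≡-Reasoning

occ-suffix-zero : ∀ x p q → occ x (p ++ x ∷ q) ≡ 1 → occ x q ≡ 0
occ-suffix-zero x p q once = m+n≡0⇒n≡0 (occ x p) (suc-injective (begin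
  suc (occ x p + occ x q)  ≡⟨ sym (+-suc (occ x p) (occ x q)) ⟩
  occ x p + suc (occ x q)  ≡⟨ sym (occ-middle x p q) ⟩
  occ x (p ++ x ∷ q)       ≡⟨ once ⟩
  1                        ∎))
  where open ≡-Reasoning

tabulate-occ : ∀ {P : ℕ → Set} L → (∀ x → 0 < occ x L → P x) → All P L
tabulate-occ []      f = []
tabulate-occ (y ∷ L) f = f y (occ-here-pos y L) ∷ tabulate-occ L (λ x p → f x (occ-there-pos x y L p))

lookup-occ : ∀ {P : ℕ → Set} {L} → All P L → ∀ x → 0 < occ x L → P x
lookup-occ {L = y ∷ L} (py ∷ ps) x p with y ≟ x
... | yes refl = py
... | no  y≢x  = lookup-occ ps x (subst (0 <_) (occ-there x y L y≢x) p)

All<⇒occ≡0 : ∀ a u → All (a <_) u → occ a u ≡ 0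
All<⇒occ≡0 a []      []        = refl
All<⇒occ≡0 a (y ∷ u) (a<y ∷ ps) rewrite ≢⇒≡ᵇ-false y a (>⇒≢ a<y) = All<⇒occ≡0 a u ps

All≤∧occ≡0⇒All< : ∀ a u → All (a ≤_) u → occ a u ≡ 0 → All (a <_) u
All≤∧occ≡0⇒All< a []      []         _    = []
All≤∧occ≡0⇒All< a (y ∷ u) (a≤y ∷ ps) none with y ≟ a
... | yes refl = ⊥-elim (1+n≢0 (trans (sym (occ-here y u)) none))
... | no  y≢a  = ≤∧≢⇒< a≤y (≢-sym y≢a) ∷ All≤∧occ≡0⇒All< a u ps (trans (sym (occ-there a y u y≢a)) none)

All-filterᵇ : ∀ {Q : ℕ → Set} p L → All Q L → All Q (filterᵇ p L)
All-filterᵇ p []      []       = []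
All-filterᵇ p (x ∷ L) (q ∷ qs) with p x
... | true  = q ∷ All-filterᵇ p L qs
... | false = All-filterᵇ p L qs

AllPairs-filterᵇ : ∀ {R : ℕ → ℕ → Set} p L → AllPairs R L → AllPairs R (filterᵇ p L)
AllPairs-filterᵇ p []      []        = []
AllPairs-filterᵇ p (x ∷ L) (a ∷ as) with p x
... | true  = All-filterᵇ p L a ∷ AllPairs-filterᵇ p L as
... | false = AllPairs-filterᵇ p L as

length-filterᵇ : ∀ p L → length (filterᵇ p L) ≤ length L
length-filterᵇ p []      = z≤n
length-filterᵇ p (x ∷ L) with p x
... | true  = s≤s (length-filterᵇ p L)
... | false = m≤n⇒m≤1+n (length-filterᵇ p L)

occ-filterᵇ : ∀ p L m → occ m (filterᵇ p L) ≡ (if p m then occ m L else 0)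
occ-filterᵇ p []      m with p m
... | true  = refl
... | false = refl
occ-filterᵇ p (x ∷ L) m with x ≟ m
... | yes refl with p x in px
...   | true  rewrite ≡ᵇ-refl x | occ-filterᵇ p L x | px = refl
...   | false rewrite occ-filterᵇ p L x | px = refl
occ-filterᵇ p (x ∷ L) m | no x≢m with p x
...   | true  rewrite ≢⇒≡ᵇ-false x m x≢m = occ-filterᵇ p L m
...   | false rewrite ≢⇒≡ᵇ-false x m x≢m = occ-filterᵇ p L m

occ-concat-map-≡ : ∀ x μ (h : ℕ → List ℕ) L → All (λ m → occ x (h m) ≡ occ μ (m ∷ [])) L →
  occ x (concat (map h L)) ≡ occ μ L
occ-concat-map-≡ x μ h []      []       = refl
occ-concat-map-≡ x μ h (m ∷ L) (e ∷ es) rewrite occ-++ x (h m) (concat (map h L)) | e | occ-concat-map-≡ x μ h L es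
  with m ≡ᵇ μ
... | true  = refl
... | false = refl

occ-concat-map-0 : ∀ x (h : ℕ → List ℕ) L → All (λ m → occ x (h m) ≡ 0) L → occ x (concat (map h L)) ≡ 0
occ-concat-map-0 x h []      []       = refl
occ-concat-map-0 x h (m ∷ L) (e ∷ es) rewrite occ-++ x (h m) (concat (map h L)) | e = occ-concat-map-0 x h L es

nth : List ℕ → ℕ → ℕ
nth []       _       = 0
nth (x ∷ xs) zero    = x
nth (x ∷ xs) (suc a) = nth xs a

slot-map-nth : ∀ (h : ℕ → List ℕ) ms a → a < length ms → slot (map h ms) a ≡ h (nth ms a)
slot-map-nth h (m ∷ ms) zero    _        = refl
slot-map-nth h (m ∷ ms) (suc a) (s≤s a<) = slot-map-nth h ms a a<

occ-nth : ∀ ms a → a < length ms → 0 < occ (nth ms a) ms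
occ-nth (m ∷ ms) zero    _        = occ-here-pos m ms
occ-nth (m ∷ ms) (suc a) (s≤s a<) = occ-there-pos (nth ms a) m ms (occ-nth ms a a<)

nth-≥ : ∀ ms b a → AllPairs _<_ ms → All (b ≤_) ms → a < length ms → a + b ≤ nth ms a
nth-≥ (m ∷ ms) b zero    _             (b≤m ∷ _)  _        = b≤m
nth-≥ (m ∷ ms) b (suc a) (m< ∷ sorted) (b≤m ∷ bs) (s≤s a<) =
  subst (_≤ nth ms a) (+-suc a b) (nth-≥ ms (suc b) a sorted (All.map (≤-<-trans b≤m) m<) a<)

nth-mono : ∀ ms a b → AllPairs _<_ ms → a ≤ b → b < length ms → nth ms a ≤ nth ms b
nth-mono (m ∷ ms) zero    zero    _             _       _        = ≤-refl
nth-mono (m ∷ ms) zero    (suc b) (m< ∷ _)      _       (s≤s b<) = <⇒≤ (lookup-occ m< (nth ms b) (occ-nth ms b b<))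
nth-mono (m ∷ ms) (suc a) (suc b) (_ ∷ sorted)  (s≤s a≤b) (s≤s b<) = nth-mono ms a b sorted a≤b b<

-- Cyclic words and lists of them

data Next (w : List ℕ) (x y : ℕ) : Set where
  inside : ∀ p q → w ≡ p ++ x ∷ y ∷ q → Next w x y
  around : ∀ p q → w ≡ y ∷ q → w ≡ p ++ x ∷ [] → Next w x y

last-view : ∀ (x : ℕ) xs → Σ (List ℕ) λ p → Σ ℕ λ z → x ∷ xs ≡ p ++ z ∷ []
last-view x []       = [] , x , refl
last-view x (y ∷ xs) with last-view y xs
... | p , z , e = x ∷ p , z , cong (x ∷_) e

++-∷-nonempty : ∀ (p : List ℕ) x q → p ++ x ∷ q ≢ []
++-∷-nonempty []      x q ()
++-∷-nonempty (_ ∷ _) x q ()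

nextAux-skip : ∀ f a L x → a ≢ x → L ≢ [] → nextAux f (a ∷ L) x ≡ nextAux f L x
nextAux-skip f a []      x a≢x L≢[] = ⊥-elim (L≢[] refl)
nextAux-skip f a (b ∷ L) x a≢x L≢[] rewrite ≢⇒≡ᵇ-false a x a≢x = refl

nextAux-skip-prefix : ∀ f p x L → occ x p ≡ 0 → nextAux f (p ++ x ∷ L) x ≡ nextAux f (x ∷ L) x
nextAux-skip-prefix f []      x L p₀ = refl
nextAux-skip-prefix f (a ∷ p) x L p₀ with a ≟ x
... | yes refl = ⊥-elim (1+n≢0 (trans (sym (occ-here a p)) p₀))
... | no  a≢x  = trans (nextAux-skip f a (p ++ x ∷ L) x a≢x (++-∷-nonempty p x L))
                       (nextAux-skip-prefix f p x L (trans (sym (occ-there x a p a≢x)) p₀))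

nextAux-absent : ∀ f L x → occ x L ≡ 0 → nextAux f L x ≡ nothing
nextAux-absent f []      x _  = refl
nextAux-absent f (a ∷ L) x L₀ with a ≟ x
... | yes refl = ⊥-elim (1+n≢0 (trans (sym (occ-here a L)) L₀))
nextAux-absent f (a ∷ [])    x L₀ | no a≢x rewrite ≢⇒≡ᵇ-false a x a≢x = refl
nextAux-absent f (a ∷ b ∷ L) x L₀ | no a≢x =
  trans (nextAux-skip f a (b ∷ L) x a≢x (λ ()))
        (nextAux-absent f (b ∷ L) x (trans (sym (occ-there x a (b ∷ L) a≢x)) L₀))

nextIn-absent : ∀ L x → occ x L ≡ 0 → nextIn L x ≡ nothing
nextIn-absent []      x _  = refl
nextIn-absent (a ∷ L) x L₀ = nextAux-absent a (a ∷ L) x L₀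

nextIn-Next : ∀ w x y → occ x w ≡ 1 → Next w x y → nextIn w x ≡ just y
nextIn-Next w x y once (inside p q refl) with p ++ x ∷ y ∷ q in e
... | []    = ⊥-elim (++-∷-nonempty p x _ e)
... | a ∷ L = subst (λ v → nextAux a v x ≡ just y) e
  (trans (nextAux-skip-prefix a p x (y ∷ q) (occ-prefix-zero x p (y ∷ q) (trans (cong (occ x) e) once)))
         (cong (λ b → if b then just y else nextAux a (y ∷ q) x) (≡ᵇ-refl x)))
nextIn-Next w x y once (around p q refl e) = begin
  nextAux y (y ∷ q) x        ≡⟨ cong (λ v → nextAux y v x) e ⟩
  nextAux y (p ++ x ∷ []) x  ≡⟨ nextAux-skip-prefix y p x [] (occ-prefix-zero x p [] (trans (cong (occ x) (sym e)) once)) ⟩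
  nextAux y (x ∷ []) x       ≡⟨ cong (λ b → if b then just y else nothing) (≡ᵇ-refl x) ⟩
  just y                     ∎
  where open ≡-Reasoning

Next-from : ∀ w x → 0 < occ x w → Σ ℕ λ y → Next w x y
Next-from w x pos with split-at-first x w pos
... | p     , y ∷ q , e , _ = y , inside p q e
... | []    , []    , e , _ = x , around [] [] e e
... | a ∷ p , []    , e , _ = a , around (a ∷ p) (p ++ x ∷ []) e e

Next-to : ∀ w x → 0 < occ x w → Σ ℕ λ z → Next w z x
Next-to w x pos with split-at-first x w pos
... | [] , q , e , _ with last-view x q
...   | p , z , e′ = z , around p q e (trans e e′)
Next-to w x pos | a ∷ p , q , e , _ with last-view a p
...   | p′ , z , e′ = z , inside p′ q (begin
  w                           ≡⟨ e ⟩
  a ∷ p ++ x ∷ q              ≡⟨ cong (_++ x ∷ q) e′ ⟩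
  (p′ ++ z ∷ []) ++ x ∷ q     ≡⟨ ++-assoc p′ (z ∷ []) (x ∷ q) ⟩
  p′ ++ z ∷ x ∷ q             ∎)
  where open ≡-Reasoning

Next-reverse : ∀ w x y → Next w x y → Next (reverse w) y x
Next-reverse w x y (inside p q e) = inside (reverse q) (reverse p) (begin
  reverse w                                   ≡⟨ cong reverse e ⟩
  reverse (p ++ x ∷ y ∷ q)                    ≡⟨ reverse-++ p (x ∷ y ∷ q) ⟩
  reverse (x ∷ y ∷ q) ++ reverse p            ≡⟨ cong (_++ reverse p) (ʳ++-defn q) ⟩
  (reverse q ++ y ∷ x ∷ []) ++ reverse p      ≡⟨ ++-assoc (reverse q) (y ∷ x ∷ []) (reverse p) ⟩
  reverse q ++ y ∷ x ∷ reverse p              ∎)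
  where open ≡-Reasoning
Next-reverse w x y (around p q e₁ e₂) = around (reverse q) (reverse p)
  (trans (cong reverse e₂) (reverse-++ p (x ∷ [])))
  (trans (cong reverse e₁) (unfold-reverse y q))

Next-occˡ : ∀ {w x y} → Next w x y → 0 < occ x w
Next-occˡ (inside p q refl)  = occ-middle-pos _ p _
Next-occˡ (around p q _ refl) = occ-middle-pos _ p []

Next-occʳ : ∀ {w x y} → Next w x y → 0 < occ y w
Next-occʳ {w} {x} {y} nx = subst (0 <_) (occ-reverse y w) (Next-occˡ (Next-reverse w x y nx))

occ-concat-∷ : ∀ x V w V′ → occ x (concat (V ++ w ∷ V′)) ≡ occ x (concat V) + (occ x w + occ x (concat V′))
occ-concat-∷ x V w V′ = trans (occ-concat-++ x V (w ∷ V′)) (cong (occ x (concat V) +_) (occ-++ x w (concat V′)))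

occ-concat-pos : ∀ x V w V′ → 0 < occ x w → 0 < occ x (concat (V ++ w ∷ V′))
occ-concat-pos x V w V′ p rewrite occ-concat-∷ x V w V′ =
  ≤-trans (≤-trans p (m≤m+n (occ x w) (occ x (concat V′)))) (m≤n+m _ (occ x (concat V)))

occ-concat-once : ∀ x V w V′ → occ x (concat (V ++ w ∷ V′)) ≡ 1 → 0 < occ x w →
  (occ x w ≡ 1) × (occ x (concat V) ≡ 0)
occ-concat-once x V w V′ once p with occ x (concat V) | occ x w | occ-concat-∷ x V w V′
... | zero  | suc zero    | _ = refl , refl
... | zero  | suc (suc k) | e = ⊥-elim (1+n≢0 (suc-injective (trans (sym e) once)))
... | suc a | suc b       | e = ⊥-elim (m+1+n≢0 a (suc-injective (trans (sym e) once)))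

occ-concat-reverse : ∀ x W → occ x (concat (map reverse W)) ≡ occ x (concat W)
occ-concat-reverse x []      = refl
occ-concat-reverse x (w ∷ W)
  rewrite occ-++ x (reverse w) (concat (map reverse W)) | occ-++ x w (concat W)
        | occ-reverse x w | occ-concat-reverse x W = refl

wordsPerm-nextIn : ∀ V w V′ x y → occ x (concat V) ≡ 0 → nextIn w x ≡ just y → wordsPerm (V ++ w ∷ V′) x ≡ y
wordsPerm-nextIn []      w V′ x y _ e rewrite e = refl
wordsPerm-nextIn (v ∷ V) w V′ x y absent e rewrite occ-++ x v (concat V) with occ x v in v₀
... | zero rewrite nextIn-absent v x v₀ = wordsPerm-nextIn V w V′ x y absent e

wordsPerm-Next : ∀ V w V′ x y → occ x (concat (V ++ w ∷ V′)) ≡ 1 → Next w x y → wordsPerm (V ++ w ∷ V′) x ≡ y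
wordsPerm-Next V w V′ x y once nx with occ-concat-once x V w V′ once (Next-occˡ nx)
... | in-w , not-in-V = wordsPerm-nextIn V w V′ x y not-in-V (nextIn-Next w x y in-w nx)

split-at-word : ∀ x W → 0 < occ x (concat W) →
  Σ (List (List ℕ)) λ V → Σ (List ℕ) λ w → Σ (List (List ℕ)) λ V′ → (W ≡ V ++ w ∷ V′) × (0 < occ x w)
split-at-word x (w ∷ W) p rewrite occ-++ x w (concat W) with occ x w in c
... | suc k = [] , w , W , refl , subst (0 <_) (sym c) z<s
... | zero with split-at-word x W p
...   | V , v , V′ , refl , q = w ∷ V , v , V′ , refl , q

slot-at : ∀ (V : List (List ℕ)) w V′ → slot (V ++ w ∷ V′) (length V) ≡ w
slot-at []      w V′ = refl
slot-at (v ∷ V) w V′ = slot-at V w V′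

slot-beyond : ∀ (ws : List (List ℕ)) a → length ws ≤ a → slot ws a ≡ []
slot-beyond []       a       _         = refl
slot-beyond (w ∷ ws) (suc a) (s≤s ≤a) = slot-beyond ws a ≤a

occupied-slot-< : ∀ ws a x → 0 < occ x (slot ws a) → a < length ws
occupied-slot-< ws a x p with a <? length ws
... | yes a< = a<
... | no  a≮ = ⊥-elim (<-irrefl refl (subst (λ v → 0 < occ x v) (slot-beyond ws a (≮⇒≥ a≮)) p))

slot-split : ∀ (ws : List (List ℕ)) a → a < length ws →
  Σ (List (List ℕ)) λ V → Σ (List (List ℕ)) λ V′ → ws ≡ V ++ slot ws a ∷ V′
slot-split (w ∷ ws) zero    _         = [] , ws , refl
slot-split (w ∷ ws) (suc a) (s≤s a<) with slot-split ws a a<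
... | V , V′ , e = w ∷ V , V′ , cong (w ∷_) e

slot-map : ∀ (h : List ℕ → List ℕ) → h [] ≡ [] → ∀ ws a → slot (map h ws) a ≡ h (slot ws a)
slot-map h h[] []       a       = sym h[]
slot-map h h[] (w ∷ ws) zero    = refl
slot-map h h[] (w ∷ ws) (suc a) = slot-map h h[] ws a

slot-clearSlot-≡ : ∀ ws j → slot (clearSlot ws j) j ≡ []
slot-clearSlot-≡ []       j       = refl
slot-clearSlot-≡ (w ∷ ws) zero    = refl
slot-clearSlot-≡ (w ∷ ws) (suc j) = slot-clearSlot-≡ ws j

slot-clearSlot-≢ : ∀ ws j a → a ≢ j → slot (clearSlot ws j) a ≡ slot ws a
slot-clearSlot-≢ []       j       a       _   = refl
slot-clearSlot-≢ (w ∷ ws) zero    zero    a≢j = ⊥-elim (a≢j refl)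
slot-clearSlot-≢ (w ∷ ws) zero    (suc a) _   = refl
slot-clearSlot-≢ (w ∷ ws) (suc j) zero    _   = refl
slot-clearSlot-≢ (w ∷ ws) (suc j) (suc a) a≢j = slot-clearSlot-≢ ws j a (a≢j ∘ cong suc)

occ-clearSlot : ∀ x ws j → occ x (concat ws) ≡ occ x (concat (clearSlot ws j)) + occ x (slot ws j)
occ-clearSlot x []       j       = refl
occ-clearSlot x (w ∷ ws) zero    rewrite occ-++ x w (concat ws) = +-comm (occ x w) _
occ-clearSlot x (w ∷ ws) (suc j)
  rewrite occ-++ x w (concat ws) | occ-++ x w (concat (clearSlot ws j)) | occ-clearSlot x ws j =
  sym (+-assoc (occ x w) _ _)

occ-slot≤occ-concat : ∀ x ws a → occ x (slot ws a) ≤ occ x (concat ws)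
occ-slot≤occ-concat x []       a       = z≤n
occ-slot≤occ-concat x (w ∷ ws) zero    rewrite occ-++ x w (concat ws) = m≤m+n _ _
occ-slot≤occ-concat x (w ∷ ws) (suc a) rewrite occ-++ x w (concat ws) =
  ≤-trans (occ-slot≤occ-concat x ws a) (m≤n+m _ _)

occ-two-slots : ∀ x ws a b → a ≢ b → occ x (slot ws a) + occ x (slot ws b) ≤ occ x (concat ws)
occ-two-slots x ws a b a≢b rewrite occ-clearSlot x ws b =
  +-monoˡ-≤ (occ x (slot ws b))
    (subst (λ v → occ x v ≤ _) (slot-clearSlot-≢ ws b a a≢b) (occ-slot≤occ-concat x (clearSlot ws b) a))

occ-once⇒one-slot : ∀ x ws a b → occ x (concat ws) ≡ 1 → 0 < occ x (slot ws a) → 0 < occ x (slot ws b) → a ≡ b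
occ-once⇒one-slot x ws a b once pa pb with a ≟ b
... | yes a≡b = a≡b
... | no  a≢b = ⊥-elim (<-irrefl refl
  (≤-trans (+-mono-≤ pa pb) (subst (occ x (slot ws a) + occ x (slot ws b) ≤_) once (occ-two-slots x ws a b a≢b))))

length-slot≤ : ∀ (ws : List (List ℕ)) a → length (slot ws a) ≤ length (concat ws)
length-slot≤ []       a       = z≤n
length-slot≤ (w ∷ ws) zero    rewrite length-++ w {concat ws} = m≤m+n _ _
length-slot≤ (w ∷ ws) (suc a) rewrite length-++ w {concat ws} = ≤-trans (length-slot≤ ws a) (m≤n+m _ _)

All-slot : ∀ {Q : List ℕ → Set} ws a → All Q ws → Q [] → Q (slot ws a)
All-slot []       a       []       q[] = q[]
All-slot (w ∷ ws) zero    (q ∷ _)  _   = q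
All-slot (w ∷ ws) (suc a) (_ ∷ qs) q[] = All-slot ws a qs q[]

slotOf : ℕ → List (List ℕ) → ℕ
slotOf x []       = 0
slotOf x (w ∷ ws) with occ x w
... | zero  = suc (slotOf x ws)
... | suc _ = 0

slotOf-spec : ∀ x ws → 0 < occ x (concat ws) → 0 < occ x (slot ws (slotOf x ws)) × slotOf x ws < length ws
slotOf-spec x (w ∷ ws) p rewrite occ-++ x w (concat ws) with occ x w in c
... | zero  = map₂ s≤s (slotOf-spec x ws p)
... | suc k = subst (0 <_) (sym c) z<s , z<s

insertAfter-absent : ∀ j u L → occ j L ≡ 0 → insertAfter j u L ≡ L
insertAfter-absent j u []      _  = refl
insertAfter-absent j u (a ∷ L) L₀ with a ≟ j
... | yes refl = ⊥-elim (1+n≢0 (trans (sym (occ-here a L)) L₀))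
... | no  a≢j rewrite ≢⇒≡ᵇ-false a j a≢j = cong (a ∷_) (insertAfter-absent j u L L₀)

insertAfter-++ : ∀ j u A B → insertAfter j u (A ++ B) ≡ insertAfter j u A ++ insertAfter j u B
insertAfter-++ j u []      B = refl
insertAfter-++ j u (a ∷ A) B with a ≡ᵇ j
... | true  = cong (a ∷_) (trans (cong (u ++_) (insertAfter-++ j u A B)) (sym (++-assoc u (insertAfter j u A) _)))
... | false = cong (a ∷_) (insertAfter-++ j u A B)

insertAfter-∷ʳ : ∀ j u X c → c ≢ j → insertAfter j u (X ++ c ∷ []) ≡ insertAfter j u X ++ c ∷ []
insertAfter-∷ʳ j u X c c≢j rewrite insertAfter-++ j u X (c ∷ []) | ≢⇒≡ᵇ-false c j c≢j = refl

insertAfter≢[]⇒≢[] : ∀ j u L → insertAfter j u L ≢ [] → L ≢ []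
insertAfter≢[]⇒≢[] j u [] ne refl = ne refl

occ-insertAfter : ∀ x j u L → occ x (insertAfter j u L) ≡ occ x L + occ j L * occ x u
occ-u++insertAfter : ∀ x j u L → occ x (u ++ insertAfter j u L) ≡ occ x L + suc (occ j L) * occ x u

occ-insertAfter x j u []      = refl
occ-insertAfter x j u (a ∷ L) with a ≡ᵇ j
... | false with a ≡ᵇ x
...   | true  = cong suc (occ-insertAfter x j u L)
...   | false = occ-insertAfter x j u L
occ-insertAfter x j u (a ∷ L) | true with a ≡ᵇ x
...   | true  = cong suc (occ-u++insertAfter x j u L)
...   | false = occ-u++insertAfter x j u L

occ-u++insertAfter x j u L rewrite occ-++ x u (insertAfter j u L) | occ-insertAfter x j u L =
  x∙yz≈y∙xz (occ x u) (occ x L) (occ j L * occ x u)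

occ-insertAfter-fresh : ∀ x j u L → occ x u ≡ 0 → occ x (insertAfter j u L) ≡ occ x L
occ-insertAfter-fresh x j u L x∉u rewrite occ-insertAfter x j u L | x∉u | *-zeroʳ (occ j L) = +-identityʳ (occ x L)

occ-insertAfter-pos : ∀ x j u L → 0 < occ x L → 0 < occ x (insertAfter j u L)
occ-insertAfter-pos x j u L p rewrite occ-insertAfter x j u L = ≤-trans p (m≤m+n _ _)

insertAfter-once : ∀ j u L → occ j L ≡ 1 →
  Σ (List ℕ) λ p → Σ (List ℕ) λ q → (L ≡ p ++ j ∷ q) × (insertAfter j u L ≡ p ++ j ∷ (u ++ q))
insertAfter-once j u L once with split-at-first j L (subst (0 <_) (sym once) z<s)
... | p , q , refl , p₀ = p , q , refl , (begin
  insertAfter j u (p ++ j ∷ q)                     ≡⟨ insertAfter-++ j u p (j ∷ q) ⟩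
  insertAfter j u p ++ insertAfter j u (j ∷ q)     ≡⟨ cong₂ _++_ (insertAfter-absent j u p p₀) at-j ⟩
  p ++ j ∷ (u ++ q)                                ∎)
  where
  open ≡-Reasoning
  at-j : insertAfter j u (j ∷ q) ≡ j ∷ (u ++ q)
  at-j rewrite ≡ᵇ-refl j = cong (λ v → j ∷ (u ++ v)) (insertAfter-absent j u q (occ-suffix-zero j p q once))

All-insertAfter : ∀ {P : ℕ → Set} j u L → All P L → All P u → All P (insertAfter j u L)
All-insertAfter j u []      []       _  = []
All-insertAfter j u (a ∷ L) (p ∷ ps) pu with a ≡ᵇ j
... | true  = p ∷ All.++⁺ pu (All-insertAfter j u L ps pu)
... | false = p ∷ All-insertAfter j u L ps pu

occ-concat-map-insertAfter : ∀ x j u vs →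
  occ x (concat (map (insertAfter j u) vs)) ≡ occ x (concat vs) + occ j (concat vs) * occ x u
occ-concat-map-insertAfter x j u []       = refl
occ-concat-map-insertAfter x j u (v ∷ vs)
  rewrite occ-++ x (insertAfter j u v) (concat (map (insertAfter j u) vs))
        | occ-insertAfter x j u v | occ-concat-map-insertAfter x j u vs
        | occ-++ x v (concat vs) | occ-++ j v (concat vs)
        | *-distribʳ-+ (occ x u) (occ j v) (occ j (concat vs)) =
  interchange (occ x v) (occ j v * occ x u) (occ x (concat vs)) (occ j (concat vs) * occ x u)

any-≡ᵇ-pos : ∀ i L → 0 < occ i L → any (_≡ᵇ i) L ≡ true
any-≡ᵇ-pos i (a ∷ L) p with a ≡ᵇ i
... | true  = refl
... | false = any-≡ᵇ-pos i L p

any-≡ᵇ-zero : ∀ i L → occ i L ≡ 0 → any (_≡ᵇ i) L ≡ false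
any-≡ᵇ-zero i []      _  = refl
any-≡ᵇ-zero i (a ∷ L) L₀ with a ≡ᵇ i
... | false = any-≡ᵇ-zero i L L₀

EndsWith : List ℕ → ℕ → Set
EndsWith L a = Σ (List ℕ) λ X → L ≡ X ++ a ∷ []

EndsWith-unique : ∀ {L a b} → EndsWith L a → EndsWith L b → a ≡ b
EndsWith-unique {L} (X , refl) (Y , e) = proj₂ (∷ʳ-injective X Y e)

EndsWith-occ : ∀ {L a} → EndsWith L a → 0 < occ a L
EndsWith-occ {a = a} (X , refl) = occ-middle-pos a X []

EndsWith-insertAfter : ∀ {L c} j u → c ≢ j → EndsWith L c → EndsWith (insertAfter j u L) c
EndsWith-insertAfter {c = c} j u c≢j (X , refl) = insertAfter j u X , insertAfter-∷ʳ j u X c c≢j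

EndsWith-tail : ∀ {x y rest m} → EndsWith (x ∷ y ∷ rest) m → EndsWith (y ∷ rest) m
EndsWith-tail ([]    , ())
EndsWith-tail (a ∷ X , e) = X , ∷-injectiveʳ e

EndsWith-nonempty : ∀ b rest → Σ ℕ λ m → EndsWith (b ∷ rest) m
EndsWith-nonempty b rest with last-view b rest
... | X , m , e = m , X , e

Linked>⇒All< : ∀ {x xs} → Linked _>_ (x ∷ xs) → All (_< x) xs
Linked>⇒All< d with Linked⇒AllPairs (λ y<x z<y → <-trans z<y y<x) d
... | below ∷ _ = below

Linked>⇒All≤head : ∀ {x xs} → Linked _>_ (x ∷ xs) → All (_≤ x) (x ∷ xs)
Linked>⇒All≤head d = ≤-refl ∷ All.map <⇒≤ (Linked>⇒All< d)

Linked>-consecutive : ∀ p z y q → Linked _>_ (p ++ z ∷ y ∷ q) → y < z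
Linked>-consecutive []          z y q (y<z ∷ _) = y<z
Linked>-consecutive (a ∷ [])    z y q (_ ∷ d)   = Linked>-consecutive [] z y q d
Linked>-consecutive (a ∷ b ∷ p) z y q (_ ∷ d)   = Linked>-consecutive (b ∷ p) z y q d

Linked>-EndsWith⇒All≥ : ∀ B m → Linked _>_ B → EndsWith B m → All (m ≤_) B
Linked>-EndsWith⇒All≥ (x ∷ [])       m _       l = ≤-reflexive (EndsWith-unique l ([] , refl)) ∷ []
Linked>-EndsWith⇒All≥ (x ∷ y ∷ rest) m (y<x ∷ d) l with Linked>-EndsWith⇒All≥ (y ∷ rest) m d (EndsWith-tail l)
... | m≤y ∷ m≤rest = ≤-trans m≤y (<⇒≤ y<x) ∷ m≤y ∷ m≤rest
Linked>-EndsWith⇒All≥ [] m _ ([] , ())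
Linked>-EndsWith⇒All≥ [] m _ (_ ∷ _ , ())

-- Nearest smaller letters

firstAtMost : ℕ → List ℕ → ℕ → ℕ
firstAtMost d []       x = d
firstAtMost d (y ∷ ys) x = if y ≤ᵇ x then y else firstAtMost d ys x

-- Reading xs from left to right, every letter x is labelled r x = the nearest
-- letter ≤ x to its left, or d if there is none; acc holds the letters already
-- read, most recent first.
NearestSmaller : (ℕ → ℕ) → ℕ → List ℕ → List ℕ → Set
NearestSmaller r d acc []       = ⊤
NearestSmaller r d acc (x ∷ xs) = (firstAtMost d acc x ≡ r x) × NearestSmaller r d (x ∷ acc) xs

NearestSmaller-++⁻ : ∀ r d acc xs ys → NearestSmaller r d acc (xs ++ ys) →
  NearestSmaller r d acc xs × NearestSmaller r d (xs ʳ++ acc) ys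
NearestSmaller-++⁻ r d acc []       ys ns = tt , ns
NearestSmaller-++⁻ r d acc (x ∷ xs) ys (e , ns) = map₁ (e ,_) (NearestSmaller-++⁻ r d (x ∷ acc) xs ys ns)

NearestSmaller-++⁺ : ∀ r d acc xs ys → NearestSmaller r d acc xs → NearestSmaller r d (xs ʳ++ acc) ys →
  NearestSmaller r d acc (xs ++ ys)
NearestSmaller-++⁺ r d acc []       ys _        ns = ns
NearestSmaller-++⁺ r d acc (x ∷ xs) ys (e , ns) ns′ = e , NearestSmaller-++⁺ r d (x ∷ acc) xs ys ns ns′

firstAtMost-++ : ∀ d B C x → firstAtMost d (B ++ C) x ≡ firstAtMost (firstAtMost d C x) B x
firstAtMost-++ d []      C x = refl
firstAtMost-++ d (y ∷ B) C x with y ≤ᵇ x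
... | true  = refl
... | false = firstAtMost-++ d B C x

firstAtMost-found-or-default : ∀ B x →
  (∀ d d′ → firstAtMost d B x ≡ firstAtMost d′ B x) ⊎ (∀ d → firstAtMost d B x ≡ d)
firstAtMost-found-or-default []      x = inj₂ λ d → refl
firstAtMost-found-or-default (y ∷ B) x with y ≤ᵇ x
... | true  = inj₁ λ d d′ → refl
... | false = firstAtMost-found-or-default B x

firstAtMost-All> : ∀ d B x → All (x <_) B → firstAtMost d B x ≡ d
firstAtMost-All> d []      x []         = refl
firstAtMost-All> d (y ∷ B) x (x<y ∷ ps) rewrite >⇒≤ᵇ-false y x x<y = firstAtMost-All> d B x ps

firstAtMost-≤ : ∀ d B x → d ≤ x → firstAtMost d B x ≤ x
firstAtMost-≤ d []      x d≤x = d≤x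
firstAtMost-≤ d (y ∷ B) x d≤x with y ≤ᵇ x in e
... | true  = ≤ᵇ-true⇒≤ y x e
... | false = firstAtMost-≤ d B x d≤x

firstAtMost-head : ∀ d j A x → j ≤ x → firstAtMost d (j ∷ A) x ≡ j
firstAtMost-head d j A x j≤x rewrite ≤⇒≤ᵇ-true j x j≤x = refl

All-ʳ++ : ∀ {P : ℕ → Set} xs acc → All P xs → All P acc → All P (xs ʳ++ acc)
All-ʳ++ []       acc _        pacc = pacc
All-ʳ++ (x ∷ xs) acc (p ∷ ps) pacc = All-ʳ++ xs (x ∷ acc) ps (p ∷ pacc)

NearestSmaller-shift : ∀ r c j A u B → NearestSmaller r j B u → All (j <_) u →
  NearestSmaller r c (B ++ j ∷ A) u
NearestSmaller-shift r c j A []      B _        _            = tt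
NearestSmaller-shift r c j A (x ∷ u) B (e , ns) (j<x ∷ j<u) =
  trans (firstAtMost-++ c B (j ∷ A) x) (trans (cong (λ d → firstAtMost d B x) (firstAtMost-head c j A x (<⇒≤ j<x))) e) ,
  NearestSmaller-shift r c j A u (x ∷ B) ns j<u

-- A letter x not labelled j has its label inside B, or else x < j, and then x
-- skips the letters of U as well.
NearestSmaller-insert-above : ∀ r c j A U q B → NearestSmaller r c (B ++ j ∷ A) q →
  All (λ x → r x ≢ j) q → All (j <_) U → NearestSmaller r c (B ++ U ++ j ∷ A) q
NearestSmaller-insert-above r c j A U []      B _        _          _   = tt
NearestSmaller-insert-above r c j A U (x ∷ q) B (e , ns) (rx≢j ∷ rs) j<U =
  label , NearestSmaller-insert-above r c j A U q (x ∷ B) ns rs j<U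
  where
  open ≡-Reasoning
  label : firstAtMost c (B ++ U ++ j ∷ A) x ≡ r x
  label with firstAtMost-found-or-default B x
  ... | inj₁ found = trans (firstAtMost-++ c B (U ++ j ∷ A) x)
                           (trans (found _ _) (trans (sym (firstAtMost-++ c B (j ∷ A) x)) e))
  ... | inj₂ default with j ≤? x
  ...   | yes j≤x = ⊥-elim (rx≢j (begin
    r x                                          ≡⟨ sym e ⟩
    firstAtMost c (B ++ j ∷ A) x                 ≡⟨ firstAtMost-++ c B (j ∷ A) x ⟩
    firstAtMost (firstAtMost c (j ∷ A) x) B x    ≡⟨ default _ ⟩
    firstAtMost c (j ∷ A) x                      ≡⟨ firstAtMost-head c j A x j≤x ⟩
    j                                            ∎))
  ...   | no  j≰x = begin
    firstAtMost c (B ++ U ++ j ∷ A) x                   ≡⟨ firstAtMost-++ c B (U ++ j ∷ A) x ⟩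
    firstAtMost (firstAtMost c (U ++ j ∷ A) x) B x      ≡⟨ default _ ⟩
    firstAtMost c (U ++ j ∷ A) x                        ≡⟨ firstAtMost-++ c U (j ∷ A) x ⟩
    firstAtMost (firstAtMost c (j ∷ A) x) U x           ≡⟨ firstAtMost-All> _ U x (All.map (<-trans (≰⇒> j≰x)) j<U) ⟩
    firstAtMost c (j ∷ A) x                             ≡⟨ sym (default _) ⟩
    firstAtMost (firstAtMost c (j ∷ A) x) B x           ≡⟨ sym (firstAtMost-++ c B (j ∷ A) x) ⟩
    firstAtMost c (B ++ j ∷ A) x                        ≡⟨ e ⟩
    r x                                                 ∎

NearestSmaller-insertAfter : ∀ r c j u L → NearestSmaller r c [] L → NearestSmaller r j [] u →
  All (j <_) u → All (λ x → r x ≢ j) L → occ j L ≤ 1 → NearestSmaller r c [] (insertAfter j u L)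
NearestSmaller-insertAfter r c j u L nsL nsu j<u rL≢j ≤1 with occ j L in jL
... | zero        = subst (NearestSmaller r c []) (sym (insertAfter-absent j u L jL)) nsL
... | suc (suc k) = ⊥-elim (<⇒≱ (s≤s (s≤s z≤n)) ≤1)
... | suc zero with insertAfter-once j u L jL
...   | p , q , refl , ins = subst (NearestSmaller r c []) (sym ins)
  (NearestSmaller-++⁺ r c [] p (j ∷ (u ++ q)) nsp (e , NearestSmaller-++⁺ r c (j ∷ A) u q nsu′ nsq′))
  where
  A = reverse p
  split = NearestSmaller-++⁻ r c [] p (j ∷ q) nsL
  nsp = proj₁ split
  e = proj₁ (proj₂ split)
  nsq = proj₂ (proj₂ split)
  rq≢j : All (λ x → r x ≢ j) q
  rq≢j with All.++⁻ʳ p rL≢j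
  ... | _ ∷ t = t
  nsu′ : NearestSmaller r c (j ∷ A) u
  nsu′ = NearestSmaller-shift r c j A u [] nsu j<u
  nsq′ : NearestSmaller r c (u ʳ++ j ∷ A) q
  nsq′ = subst (λ acc → NearestSmaller r c acc q) (sym (ʳ++-defn u))
           (NearestSmaller-insert-above r c j A (reverse u) q [] nsq rq≢j (All-ʳ++ u [] j<u []))

NearestSmaller-decreasing : ∀ r a L acc → Linked _>_ L → All (λ y → All (_< y) L) acc →
  (∀ x → 0 < occ x L → r x ≡ a) → NearestSmaller r a acc L
NearestSmaller-decreasing r a []      acc _ _     _ = tt
NearestSmaller-decreasing r a (x ∷ L) acc d above ra =
  trans (firstAtMost-All> a acc x (All.map All.head above)) (sym (ra x (occ-here-pos x L))) ,
  NearestSmaller-decreasing r a L (x ∷ acc) (Linked.tail d) (Linked>⇒All< d ∷ All.map All.tail above)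
    (λ z p → ra z (occ-there-pos z x L p))

-- The steps of β

module βLoop (n : ℕ) (r : ℕ → ℕ) where

  -- The state before the steps for the indices J, J-1, …, 1 of β; r x is meant to
  -- be the index of the cycle of σ₁ containing x.
  record Invariant (J : ℕ) (ws : List (List ℕ)) : Set where
    field
      bounded       : J ≡ 0 ⊎ J < n
      letters       : ∀ x → occ x (concat ws) ≡ χ n x
      slot-above    : ∀ a → All (a ≤_) (slot ws a)
      ends-with-own : ∀ a → 0 < occ a (slot ws a) → EndsWith (slot ws a) a
      labels        : ∀ a → NearestSmaller r a [] (slot ws a)
      complete      : ∀ a x → a ≤ J → r x ≡ a → x < n → 0 < occ x (slot ws a)
      pending       : ∀ a → J < a → slot ws a ≢ [] → 0 < occ a (slot ws a)

  open Invariant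

  keep-preserves : ∀ j ws → Invariant (suc j) ws → 0 < occ (suc j) (slot ws (suc j)) → Invariant j ws
  keep-preserves j ws I i∈u = record
    { bounded       = [ (λ ()) , (λ 1+j<n → inj₂ (<-trans (n<1+n j) 1+j<n)) ]′ (bounded I)
    ; letters       = letters I
    ; slot-above    = slot-above I
    ; ends-with-own = ends-with-own I
    ; labels        = labels I
    ; complete      = λ a x a≤j → complete I a x (m≤n⇒m≤1+n a≤j)
    ; pending       = pending′
    }
    where
    pending′ : ∀ a → j < a → slot ws a ≢ [] → 0 < occ a (slot ws a)
    pending′ a j<a ne with a ≟ suc j
    ... | yes refl = i∈u
    ... | no  a≢i  = pending I a (≤∧≢⇒< j<a (≢-sym a≢i)) ne

  module Insertion (j : ℕ) (ws : List (List ℕ)) (I : Invariant (suc j) ws)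
                   (i∉u : occ (suc j) (slot ws (suc j)) ≡ 0) where

    i = suc j
    u = slot ws i
    ws′ = map (insertAfter i u) (clearSlot ws i)

    i<n : i < n
    i<n = [ (λ ()) , (λ i<n → i<n) ]′ (bounded I)

    slot-≢ : ∀ a → a ≢ i → slot ws′ a ≡ insertAfter i u (slot ws a)
    slot-≢ a a≢i = trans (slot-map (insertAfter i u) refl (clearSlot ws i) a)
                         (cong (insertAfter i u) (slot-clearSlot-≢ ws i a a≢i))

    slot-≡ : slot ws′ i ≡ []
    slot-≡ = trans (slot-map (insertAfter i u) refl (clearSlot ws i) i)
                   (cong (insertAfter i u) (slot-clearSlot-≡ ws i))

    once : ∀ {x} → x < n → occ x (concat ws) ≡ 1
    once x<n = trans (letters I _) (χ-< x<n)

    i-once-elsewhere : occ i (concat (clearSlot ws i)) ≡ 1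
    i-once-elsewhere = begin
      occ i (concat (clearSlot ws i))                 ≡⟨ sym (+-identityʳ _) ⟩
      occ i (concat (clearSlot ws i)) + 0             ≡⟨ cong (occ i (concat (clearSlot ws i)) +_) (sym i∉u) ⟩
      occ i (concat (clearSlot ws i)) + occ i u       ≡⟨ sym (occ-clearSlot i ws i) ⟩
      occ i (concat ws)                               ≡⟨ once i<n ⟩
      1                                               ∎
      where open ≡-Reasoning

    letters′ : ∀ x → occ x (concat ws′) ≡ χ n x
    letters′ x = begin
      occ x (concat ws′)                                                     ≡⟨ occ-concat-map-insertAfter x i u (clearSlot ws i) ⟩
      occ x (concat (clearSlot ws i)) + occ i (concat (clearSlot ws i)) * occ x u ≡⟨ cong (λ k → occ x (concat (clearSlot ws i)) + k * occ x u) i-once-elsewhere ⟩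
      occ x (concat (clearSlot ws i)) + 1 * occ x u                          ≡⟨ cong (occ x (concat (clearSlot ws i)) +_) (*-identityˡ (occ x u)) ⟩
      occ x (concat (clearSlot ws i)) + occ x u                              ≡⟨ sym (occ-clearSlot x ws i) ⟩
      occ x (concat ws)                                                      ≡⟨ letters I x ⟩
      χ n x                                                                  ∎
      where open ≡-Reasoning

    u-above : All (i <_) u
    u-above = All≤∧occ≡0⇒All< i u (slot-above I i) i∉u

    a≤i-if-i∈slot : ∀ a → 0 < occ i (slot ws a) → a ≤ i
    a≤i-if-i∈slot a = lookup-occ (slot-above I a) i

    slot-above′ : ∀ a → All (a ≤_) (slot ws′ a)
    slot-above′ a with a ≟ i
    ... | yes refl rewrite slot-≡ = []
    ... | no  a≢i rewrite slot-≢ a a≢i with occ i (slot ws a) in c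
    ...   | zero  rewrite insertAfter-absent i u (slot ws a) c = slot-above I a
    ...   | suc _ = All-insertAfter i u (slot ws a) (slot-above I a)
                      (All.map (λ i<y → ≤-trans (a≤i-if-i∈slot a (subst (0 <_) (sym c) z<s)) (<⇒≤ i<y)) u-above)

    ends-with-own′ : ∀ a → 0 < occ a (slot ws′ a) → EndsWith (slot ws′ a) a
    ends-with-own′ a a∈ with a ≟ i
    ... | yes refl rewrite slot-≡ = ⊥-elim (<-irrefl refl a∈)
    ... | no  a≢i rewrite slot-≢ a a≢i = EndsWith-insertAfter i u a≢i (ends-with-own I a a∈-before)
      where
      a∈-before : 0 < occ a (slot ws a)
      a∈-before with occ i (slot ws a) in c
      ... | zero  = subst (λ v → 0 < occ a v) (insertAfter-absent i u (slot ws a) c) a∈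
      ... | suc _ = subst (0 <_) (occ-insertAfter-fresh a i u (slot ws a) a∉u) a∈
        where
        a<i = ≤∧≢⇒< (a≤i-if-i∈slot a (subst (0 <_) (sym c) z<s)) a≢i
        a∉u = All<⇒occ≡0 a u (All.map (<-trans a<i) u-above)

    no-label-i-elsewhere : ∀ a → a ≢ i → All (λ x → r x ≢ i) (slot ws a)
    no-label-i-elsewhere a a≢i = tabulate-occ (slot ws a) λ x x∈a rx≡i →
      let x<n = χ-pos⇒< (subst (0 <_) (letters I x) (≤-trans x∈a (occ-slot≤occ-concat x ws a)))
      in a≢i (occ-once⇒one-slot x ws a i (once x<n) x∈a (complete I i x ≤-refl rx≡i x<n))

    labels′ : ∀ a → NearestSmaller r a [] (slot ws′ a)
    labels′ a with a ≟ i
    ... | yes refl rewrite slot-≡ = tt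
    ... | no  a≢i rewrite slot-≢ a a≢i =
      NearestSmaller-insertAfter r a i u (slot ws a) (labels I a) (labels I i) u-above (no-label-i-elsewhere a a≢i)
        (subst (occ i (slot ws a) ≤_) (once i<n) (occ-slot≤occ-concat i ws a))

    complete′ : ∀ a x → a ≤ j → r x ≡ a → x < n → 0 < occ x (slot ws′ a)
    complete′ a x a≤j rx≡a x<n rewrite slot-≢ a (<⇒≢ (s≤s a≤j)) =
      occ-insertAfter-pos x i u (slot ws a) (complete I a x (m≤n⇒m≤1+n a≤j) rx≡a x<n)

    pending′ : ∀ a → j < a → slot ws′ a ≢ [] → 0 < occ a (slot ws′ a)
    pending′ a j<a ne with a ≟ i
    ... | yes refl = ⊥-elim (ne slot-≡)
    ... | no  a≢i rewrite slot-≢ a a≢i =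
      occ-insertAfter-pos a i u (slot ws a)
        (pending I a (≤∧≢⇒< j<a (≢-sym a≢i)) (insertAfter≢[]⇒≢[] i u (slot ws a) ne))

    invariant : Invariant j ws′
    invariant = record
      { bounded       = inj₂ (<-trans (n<1+n j) i<n)
      ; letters       = letters′
      ; slot-above    = slot-above′
      ; ends-with-own = ends-with-own′
      ; labels        = labels′
      ; complete      = complete′
      ; pending       = pending′
      }

  βstep-preserves : ∀ j ws → Invariant (suc j) ws → Invariant j (βstep (suc j) ws)
  βstep-preserves j ws I with occ (suc j) (slot ws (suc j)) in c
  ... | zero  rewrite any-≡ᵇ-zero (suc j) (slot ws (suc j)) c = Insertion.invariant j ws I c
  ... | suc k rewrite any-≡ᵇ-pos (suc j) (slot ws (suc j)) (subst (0 <_) (sym c) z<s) =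
    keep-preserves j ws I (subst (0 <_) (sym c) z<s)

  βloop-preserves : ∀ J ws → Invariant J ws → Invariant 0 (βloop J ws)
  βloop-preserves zero    ws I = I
  βloop-preserves (suc J) ws I = βloop-preserves J (βstep (suc J) ws) (βstep-preserves J ws I)

-- The permutation of a list of cycle words and its inom code

data Walk (g : ℕ → ℕ) : ℕ → List ℕ → ℕ → Set where
  finish : ∀ {y e} → g y ≡ e → Walk g y [] e
  visit  : ∀ {y z S e} → g y ≡ z → Walk g z S e → Walk g y (z ∷ S) e

first-return-≤ : ∀ x a g y R → Walk g y R a → a ≤ x →
  Σ ℕ λ t → (1 ≤ t) × (iterate g y t ≡ firstAtMost a R x) × (∀ s → 1 ≤ s → s < t → x < iterate g y s)
first-return-≤ x a g y []      (finish e)   a≤x = 1 , ≤-refl , e , λ s 1≤s s<1 → ⊥-elim (<⇒≱ s<1 1≤s)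
first-return-≤ x a g y (z ∷ R) (visit e w) a≤x with z ≤ᵇ x in z≤ᵇx
... | true  = 1 , ≤-refl , e , λ s 1≤s s<1 → ⊥-elim (<⇒≱ s<1 1≤s)
... | false with first-return-≤ x a g z R w a≤x
...   | t , _ , at-t , before-t = suc t , s≤s z≤n , trans (cong (λ v → iterate g v t) e) at-t , before
  where
  before : ∀ s → 1 ≤ s → s < suc t → x < iterate g y s
  before (suc zero)    _ _          = subst (x <_) (sym e) (≤ᵇ-false⇒> z x z≤ᵇx)
  before (suc (suc s)) _ (s≤s s<t) = subst (x <_) (cong (λ v → iterate g v (suc s)) (sym e)) (before-t (suc s) (s≤s z≤n) s<t)

module WordsPermutation (n : ℕ) (W : List (List ℕ)) (letters : ∀ x → occ x (concat W) ≡ χ n x) where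

  F G : ℕ → ℕ
  F = wordsPerm W
  G = wordsPerm (map reverse W)

  once : ∀ {x} → x < n → occ x (concat W) ≡ 1
  once x<n = trans (letters _) (χ-< x<n)

  occurs : ∀ {x} → x < n → 0 < occ x (concat W)
  occurs x<n = subst (0 <_) (sym (once x<n)) z<s

  module InWord (V : List (List ℕ)) (w : List ℕ) (V′ : List (List ℕ)) (W≡ : W ≡ V ++ w ∷ V′) where

    <n : ∀ {y} → 0 < occ y w → y < n
    <n {y} y∈w = χ-pos⇒< (subst (0 <_) (trans (cong (λ v → occ y (concat v)) (sym W≡)) (letters y)) (occ-concat-pos y V w V′ y∈w))

    once′ : ∀ {y} → 0 < occ y w → occ y (concat (V ++ w ∷ V′)) ≡ 1
    once′ y∈w = trans (cong (λ v → occ _ (concat v)) (sym W≡)) (once (<n y∈w))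

    F-Next : ∀ {z y} → Next w z y → F z ≡ y
    F-Next {z} {y} nx = trans (cong (λ v → wordsPerm v z) W≡) (wordsPerm-Next V w V′ z y (once′ (Next-occˡ nx)) nx)

    G-Next : ∀ {z y} → Next w z y → G y ≡ z
    G-Next {z} {y} nx = trans (cong (λ v → wordsPerm v y) reversed)
      (wordsPerm-Next (map reverse V) (reverse w) (map reverse V′) y z
        (trans (cong (λ v → occ y (concat v)) (sym reversed))
               (trans (occ-concat-reverse y W) (trans (cong (λ v → occ y (concat v)) W≡) (once′ (Next-occʳ nx)))))
        (Next-reverse w z y nx))
      where
      reversed : map reverse W ≡ map reverse V ++ reverse w ∷ map reverse V′
      reversed = trans (cong (map reverse) W≡) (map-++ reverse V (w ∷ V′))

  F-< : ∀ {x} → x < n → F x < n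
  F-< {x} x<n with split-at-word x W (occurs x<n)
  ... | V , w , V′ , W≡ , x∈w with Next-from w x x∈w
  ...   | y , nx = subst (_< n) (sym (F-Next nx)) (<n (Next-occʳ nx))
    where open InWord V w V′ W≡

  G-< : ∀ {x} → x < n → G x < n
  G-< {x} x<n with split-at-word x W (occurs x<n)
  ... | V , w , V′ , W≡ , x∈w with Next-to w x x∈w
  ...   | z , nx = subst (_< n) (sym (G-Next nx)) (<n (Next-occˡ nx))
    where open InWord V w V′ W≡

  G∘F : ∀ {x} → x < n → G (F x) ≡ x
  G∘F {x} x<n with split-at-word x W (occurs x<n)
  ... | V , w , V′ , W≡ , x∈w with Next-from w x x∈w
  ...   | y , nx = trans (cong G (F-Next nx)) (G-Next nx)
    where open InWord V w V′ W≡

  F∘G : ∀ {x} → x < n → F (G x) ≡ x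
  F∘G {x} x<n with split-at-word x W (occurs x<n)
  ... | V , w , V′ , W≡ , x∈w with Next-to w x x∈w
  ...   | z , nx = trans (cong F (G-Next nx)) (F-Next nx)
    where open InWord V w V′ W≡

  abstract
    τ : Permutation′ n
    τ = permutation (λ i → fromℕ< (F-< (toℕ<n i))) (λ i → fromℕ< (G-< (toℕ<n i)))
      (λ y → toℕ-injective (trans (toℕ-fromℕ< _) (trans (cong F (toℕ-fromℕ< _)) (F∘G (toℕ<n y)))))
      (λ x → toℕ-injective (trans (toℕ-fromℕ< _) (trans (cong G (toℕ-fromℕ< _)) (G∘F (toℕ<n x)))))

    τ-ʳ : ∀ i → toℕ (τ ⟨$⟩ʳ i) ≡ F (toℕ i)
    τ-ʳ i = toℕ-fromℕ< _

    τ-ˡ : ∀ i → toℕ (τ ⟨$⟩ˡ i) ≡ G (toℕ i)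
    τ-ˡ i = toℕ-fromℕ< _

  invPow-iterate : ∀ t i → toℕ (invPow τ t i) ≡ iterate G (toℕ i) t
  invPow-iterate t i = trans (invPow-fold t) (iterate-is-fold (toℕ i) G t)
    where
    invPow-fold : ∀ t → toℕ (invPow τ t i) ≡ fold (toℕ i) G t
    invPow-fold zero    = refl
    invPow-fold (suc t) = trans (τ-ˡ (invPow τ t i)) (cong G (invPow-fold t))

module InomCode (n : ℕ) (r : ℕ → ℕ) (W : List (List ℕ)) (I : βLoop.Invariant n r 0 W)
  (r-0 : 0 < n → r 0 ≡ 0)
  (r-downward-closed : ∀ i b m → i < n → b ≤ i → m ≤ r b → Σ ℕ λ c → (c ≤ i) × (r c ≡ m)) where

  open βLoop.Invariant I
  open WordsPermutation n W letters

  index-in-own-slot : ∀ a → 0 < n → slot W a ≢ [] → 0 < occ a (slot W a)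
  index-in-own-slot zero    0<n _  = complete 0 0 z≤n (r-0 0<n) 0<n
  index-in-own-slot (suc a) _   ne = pending (suc a) z<s ne

  -- Going backwards from x inside its word, and from the first letter to the last
  -- one, which is the index a of the word.
  backward-walk : ∀ {x} → x < n →
    Σ ℕ λ a → Σ (List ℕ) λ R → Walk G x R a × (firstAtMost a R x ≡ r x) × (a ≤ x)
  backward-walk {x} x<n with split-at-word x W (occurs x<n)
  ... | V , w , V′ , W≡ , x∈w with split-at-first x w x∈w
  ...   | pre , suf , w≡ , _ =
    a , reverse pre , walk (reverse pre) x suf (subst (λ p → w ≡ p ++ x ∷ suf) (sym (reverse-involutive pre)) w≡) ,
    proj₁ (proj₂ (NearestSmaller-++⁻ r a [] pre (x ∷ suf) (subst (NearestSmaller r a []) w≡ labels-w))) ,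
    lookup-occ (subst (All (a ≤_)) slot-a (slot-above a)) x x∈w
    where
    open InWord V w V′ W≡
    a = length V
    slot-a : slot W a ≡ w
    slot-a = trans (cong (λ v → slot v a) W≡) (slot-at V w V′)
    labels-w : NearestSmaller r a [] w
    labels-w = subst (NearestSmaller r a []) slot-a (labels a)
    ends-with-a : EndsWith w a
    ends-with-a = subst (λ v → EndsWith v a) slot-a (ends-with-own a
      (index-in-own-slot a (≤-<-trans z≤n x<n) λ empty → <-irrefl refl (subst (λ v → 0 < occ x v) (trans (sym slot-a) empty) x∈w)))
    walk : ∀ R y suf → w ≡ reverse R ++ y ∷ suf → Walk G y R a
    walk []      y suf w≡′ = finish (G-Next (around (proj₁ ends-with-a) suf w≡′ (proj₂ ends-with-a)))
    walk (q ∷ R) y suf w≡′ = visit (G-Next (inside (reverse R) suf w≡″)) (walk R q (y ∷ suf) w≡″)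
      where
      w≡″ : w ≡ reverse R ++ q ∷ y ∷ suf
      w≡″ = trans w≡′ (trans (cong (_++ y ∷ suf) (ʳ++-defn R)) (++-assoc (reverse R) (q ∷ []) (y ∷ suf)))

  r-≤ : ∀ {x} → x < n → r x ≤ x
  r-≤ x<n with backward-walk x<n
  ... | a , R , _ , first≡r , a≤x = subst (_≤ _) first≡r (firstAtMost-≤ a R _ a≤x)

  f : Fin n → Fin n
  f i = fromℕ< (≤-<-trans (r-≤ (toℕ<n i)) (toℕ<n i))

  toℕ-f : ∀ i → toℕ (f i) ≡ r (toℕ i)
  toℕ-f i = toℕ-fromℕ< _

  f-inom : ∀ i → IsInom τ i (f i)
  f-inom i with backward-walk (toℕ<n i)
  ... | a , R , walk , first≡r , a≤x with first-return-≤ (toℕ i) a G (toℕ i) R walk a≤x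
  ...   | t , 1≤t , at-t , before-t =
    t , 1≤t ,
    toℕ-injective (trans (invPow-iterate t i) (trans at-t (trans first≡r (sym (toℕ-f i))))) ,
    subst (_≤ toℕ i) (sym (toℕ-f i)) (r-≤ (toℕ<n i)) ,
    λ s 1≤s s<t → subst (toℕ i <_) (sym (invPow-iterate s i)) (before-t s 1≤s s<t)

  f-intervals : PrefixIntervals f
  f-intervals i _ b m _ b≤i _ m≤fb
    with r-downward-closed (toℕ i) (toℕ b) (toℕ m) (toℕ<n i) b≤i (subst (toℕ m ≤_) (toℕ-f b) m≤fb)
  ... | c , c≤i , rc≡m = fromℕ< (≤-<-trans c≤i (toℕ<n i)) , subst (_≤ toℕ i) (sym (toℕ-fromℕ< _)) c≤i ,
    toℕ-injective (trans (toℕ-f _) (trans (cong r (toℕ-fromℕ< _)) rc≡m))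

  inBP₂ : InBP₂ n F
  inBP₂ = τ , τ-ʳ , f , f-inom , f-intervals

-- Orbits through decreasing cycles

maxList-≤ : ∀ {b} L → All (_≤ b) L → maxList L ≤ b
maxList-≤ []      []         = z≤n
maxList-≤ (x ∷ L) (x≤b ∷ ps) = ⊔-lub x≤b (maxList-≤ L ps)

maxList-≡ : ∀ b L → 0 < occ b L → All (_≤ b) L → maxList L ≡ b
maxList-≡ b (x ∷ L) b∈ (x≤b ∷ ps) with x ≟ b
... | yes refl = m≥n⇒m⊔n≡m (maxList-≤ L ps)
... | no  x≢b  = trans (cong (x ⊔_) (maxList-≡ b L (subst (0 <_) (occ-there b x L x≢b) b∈) ps)) (m≤n⇒m⊔n≡n x≤b)

all-≤ᵇ : ∀ m L → All (m ≤_) L → all (m ≤ᵇ_) L ≡ true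
all-≤ᵇ m []      []         = refl
all-≤ᵇ m (x ∷ L) (m≤x ∷ ps) rewrite ≤⇒≤ᵇ-true m x m≤x = all-≤ᵇ m L ps

orbitFrom-≢ : ∀ k g e y → y ≢ e → orbitFrom (suc k) g e y ≡ y ∷ orbitFrom k g e (g y)
orbitFrom-≢ k g e y y≢e rewrite ≢⇒≡ᵇ-false y e y≢e = refl

orbitFrom-Walk : ∀ g e k y S → Walk g y S e → All (_≢ e) (y ∷ S) → length S < k → orbitFrom k g e y ≡ y ∷ S
orbitFrom-Walk g e (suc k) y [] (finish gy≡e) (y≢e ∷ []) _ rewrite orbitFrom-≢ k g e y y≢e | gy≡e =
  cong (y ∷_) (stop k)
  where
  stop : ∀ k → orbitFrom k g e e ≡ []
  stop zero    = refl
  stop (suc k) rewrite ≡ᵇ-refl e = refl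
orbitFrom-Walk g e (suc k) y (z ∷ S) (visit gy≡z w) (y≢e ∷ ≢e) (s≤s |S|<k) rewrite orbitFrom-≢ k g e y y≢e | gy≡z =
  cong (y ∷_) (orbitFrom-Walk g e k z S w ≢e |S|<k)

descent⇒not-minimal : ∀ k g m y → g m ≡ y → y < m → all (m ≤ᵇ_) (orbit (suc k) g m) ≡ false
descent⇒not-minimal k g m y gm≡y y<m
  rewrite gm≡y | orbitFrom-≢ k g m y (<⇒≢ y<m) | ≤⇒≤ᵇ-true m m ≤-refl | >⇒≤ᵇ-false m y y<m = refl

orbit-Walk : ∀ k g b₀ rest → Walk g b₀ rest b₀ → All (_< b₀) rest → length rest ≤ k → orbit (suc k) g b₀ ≡ b₀ ∷ rest
orbit-Walk k g b₀ []      (finish gb₀) _ _ rewrite gb₀ | ≡ᵇ-refl b₀ = refl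
orbit-Walk k g b₀ (c ∷ S) (visit gb₀ w) below |S|<k rewrite gb₀ =
  cong (b₀ ∷_) (orbitFrom-Walk g b₀ (suc k) c S w (All.map <⇒≢ below) (m≤n⇒m≤1+n |S|<k))

module DecreasingCycle (k : ℕ) (g : ℕ → ℕ) (b₀ : ℕ) (rest : List ℕ)
  (decreasing : Linked _>_ (b₀ ∷ rest)) (g-Next : ∀ {z y} → Next (b₀ ∷ rest) z y → g z ≡ y)
  (fuel : length rest ≤ k) where

  B = b₀ ∷ rest

  g-closed : ∀ {z} → 0 < occ z B → 0 < occ (g z) B
  g-closed z∈B with Next-from B _ z∈B
  ... | y , nx = subst (λ v → 0 < occ v B) (sym (g-Next nx)) (Next-occʳ nx)

  orbitFrom-within : ∀ j e y → 0 < occ y B → All (λ z → 0 < occ z B) (orbitFrom j g e y)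
  orbitFrom-within zero    e y _   = []
  orbitFrom-within (suc j) e y y∈B with y ≡ᵇ e
  ... | true  = []
  ... | false = y∈B ∷ orbitFrom-within j e (g y) (g-closed y∈B)

  orbit-within : ∀ {m} → 0 < occ m B → All (λ z → 0 < occ z B) (orbit (suc k) g m)
  orbit-within m∈B = m∈B ∷ orbitFrom-within (suc k) _ _ (g-closed m∈B)

  minimal⇒last : ∀ m → 0 < occ m B → all (m ≤ᵇ_) (orbit (suc k) g m) ≡ true → EndsWith B m
  minimal⇒last m m∈B minimal with Next-from B m m∈B
  ... | y , around p q _ e = p , e
  ... | y , inside p q e with () ← trans (sym minimal)
    (descent⇒not-minimal k g m y (g-Next (inside p q e)) (Linked>-consecutive p m y q (subst (Linked _>_) e decreasing)))

  last⇒minimal : ∀ m → EndsWith B m → all (m ≤ᵇ_) (orbit (suc k) g m) ≡ true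
  last⇒minimal m ends = all-≤ᵇ m (orbit (suc k) g m)
    (All.map (lookup-occ (Linked>-EndsWith⇒All≥ B m decreasing ends) _) (orbit-within (EndsWith-occ ends)))

  walk-to-head : ∀ pre y S → B ≡ pre ++ y ∷ S → Walk g y S b₀
  walk-to-head pre y []      e = finish (g-Next (around pre rest refl e))
  walk-to-head pre y (z ∷ S) e =
    visit (g-Next (inside pre S e)) (walk-to-head (pre ++ y ∷ []) z S (trans e (sym (++-assoc pre (y ∷ []) (z ∷ S)))))

  orbit-head : orbit (suc k) g b₀ ≡ B
  orbit-head = orbit-Walk k g b₀ rest (walk-to-head [] b₀ rest refl) (Linked>⇒All< decreasing) fuel

  last⇒cycleWord : ∀ m → EndsWith B m → orbit (suc k) g (maxList (orbit (suc k) g m)) ≡ B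
  last⇒cycleWord m ends = trans (cong (orbit (suc k) g) max≡b₀) orbit-head
    where
    gm≡b₀ : g m ≡ b₀
    gm≡b₀ = g-Next (around (proj₁ ends) rest refl (proj₂ ends))
    b₀∈orbit : 0 < occ b₀ (orbit (suc k) g m)
    b₀∈orbit with b₀ ≟ m
    ... | yes refl = occ-here-pos b₀ (orbitFrom (suc k) g b₀ (g b₀))
    ... | no  b₀≢m rewrite gm≡b₀ | orbitFrom-≢ k g m b₀ b₀≢m =
      occ-there-pos b₀ m (b₀ ∷ orbitFrom k g m (g b₀)) (occ-here-pos b₀ (orbitFrom k g m (g b₀)))
    max≡b₀ : maxList (orbit (suc k) g m) ≡ b₀
    max≡b₀ = maxList-≡ b₀ _ b₀∈orbit
      (All.map (lookup-occ (Linked>⇒All≤head decreasing) _) (orbit-within (EndsWith-occ ends)))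

record IsDecreasingCycle (k : ℕ) (g : ℕ → ℕ) (B : List ℕ) : Set where
  field
    decreasing : Linked _>_ B
    g-Next     : ∀ {z y} → Next B z y → g z ≡ y
    fuel       : length B ≤ k

cycle-minimal⇒last : ∀ {k g B} → IsDecreasingCycle k g B → ∀ m → 0 < occ m B →
  all (m ≤ᵇ_) (orbit k g m) ≡ true → EndsWith B m
cycle-minimal⇒last {B = []}        _ m ()
cycle-minimal⇒last {k} {g} {b₀ ∷ rest} C with k | IsDecreasingCycle.fuel C
... | suc k′ | s≤s fuel′ = DecreasingCycle.minimal⇒last k′ g b₀ rest (IsDecreasingCycle.decreasing C) (IsDecreasingCycle.g-Next C) fuel′

cycle-last⇒minimal : ∀ {k g B} → IsDecreasingCycle k g B → ∀ m → EndsWith B m →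
  all (m ≤ᵇ_) (orbit k g m) ≡ true
cycle-last⇒minimal {k} {g} {b₀ ∷ rest} C with k | IsDecreasingCycle.fuel C
... | suc k′ | s≤s fuel′ = DecreasingCycle.last⇒minimal k′ g b₀ rest (IsDecreasingCycle.decreasing C) (IsDecreasingCycle.g-Next C) fuel′
cycle-last⇒minimal {B = []} _ m ([]    , ())
cycle-last⇒minimal {B = []} _ m (_ ∷ _ , ())

cycle-last⇒cycleWord : ∀ {k g B} → IsDecreasingCycle k g B → ∀ m → EndsWith B m →
  orbit k g (maxList (orbit k g m)) ≡ B
cycle-last⇒cycleWord {k} {g} {b₀ ∷ rest} C with k | IsDecreasingCycle.fuel C
... | suc k′ | s≤s fuel′ = DecreasingCycle.last⇒cycleWord k′ g b₀ rest (IsDecreasingCycle.decreasing C) (IsDecreasingCycle.g-Next C) fuel′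
cycle-last⇒cycleWord {B = []} _ m ([]    , ())
cycle-last⇒cycleWord {B = []} _ m (_ ∷ _ , ())

-- The cycle words of σ₁ ∈ BP₁(n)

module InitialWords (n : ℕ) (σ₁ : Permutation′ n) (P : List (List ℕ))
  (P-decreasing : All (Linked _>_) P) (P-partition : concat P ↭ upTo n)
  (σ₁≡ : ∀ i → toℕ (σ₁ ⟨$⟩ʳ i) ≡ wordsPerm P (toℕ i)) where

  g : ℕ → ℕ
  g = fun σ₁

  g≡wordsPerm : ∀ {x} → x < n → g x ≡ wordsPerm P x
  g≡wordsPerm {x} x<n with x <? n
  ... | yes x<n′ = trans (σ₁≡ (fromℕ< x<n′)) (cong (wordsPerm P) (toℕ-fromℕ< x<n′))
  ... | no  x≮n  = ⊥-elim (x≮n x<n)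

  occ-P : ∀ x → occ x (concat P) ≡ χ n x
  occ-P x = trans (occ-↭ x P-partition) (occ-upTo x n)

  once-P : ∀ {x} → x < n → occ x (concat P) ≡ 1
  once-P x<n = trans (occ-P _) (χ-< x<n)

  block : ℕ → List ℕ
  block x = slot P (slotOf x P)

  in-own-block : ∀ {x} → x < n → 0 < occ x (block x)
  in-own-block x<n = proj₁ (slotOf-spec _ P (subst (0 <_) (sym (once-P x<n)) z<s))

  in-block⇒< : ∀ {c z} → 0 < occ z (slot P c) → z < n
  in-block⇒< {c} {z} z∈ = χ-pos⇒< (subst (0 <_) (occ-P z) (≤-trans z∈ (occ-slot≤occ-concat z P c)))

  block-of-member : ∀ {c z} → 0 < occ z (slot P c) → slotOf z P ≡ c
  block-of-member z∈ = occ-once⇒one-slot _ P _ _ (once-P (in-block⇒< z∈)) (in-own-block (in-block⇒< z∈)) z∈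

  block-cycle : ∀ c → IsDecreasingCycle n g (slot P c)
  block-cycle c = record
    { decreasing = All-slot P c P-decreasing []
    ; g-Next     = follows
    ; fuel       = subst (length (slot P c) ≤_) (trans (↭-length P-partition) (length-upTo n)) (length-slot≤ P c)
    }
    where
    follows : ∀ {z y} → Next (slot P c) z y → g z ≡ y
    follows {z} {y} nx with slot-split P c (occupied-slot-< P c z (Next-occˡ nx))
    ... | V , V′ , P≡ = trans (g≡wordsPerm (in-block⇒< (Next-occˡ nx))) (trans (cong (λ v → wordsPerm v z) P≡)
      (wordsPerm-Next V (slot P c) V′ z y
        (trans (cong (λ v → occ z (concat v)) (sym P≡)) (once-P (in-block⇒< (Next-occˡ nx)))) nx))

  isMinimal : ℕ → Bool
  isMinimal m = all (m ≤ᵇ_) (orbit n g m)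

  cycleWord : ℕ → List ℕ
  cycleWord m = orbit n g (maxList (orbit n g m))

  mins : List ℕ
  mins = cycleMinima σ₁

  ws₀ : List (List ℕ)
  ws₀ = cycleWords σ₁

  occ-mins : ∀ m → occ m mins ≡ (if isMinimal m then χ n m else 0)
  occ-mins m = trans (occ-filterᵇ isMinimal (upTo n) m) (cong (λ o → if isMinimal m then o else 0) (occ-upTo m n))

  min⇒< : ∀ {m} → 0 < occ m mins → m < n
  min⇒< {m} m∈ with isMinimal m | occ-mins m
  ... | true  | o = χ-pos⇒< (subst (0 <_) o m∈)
  ... | false | o = ⊥-elim (<-irrefl (sym o) m∈)

  min⇒isMinimal : ∀ {m} → 0 < occ m mins → isMinimal m ≡ true
  min⇒isMinimal {m} m∈ with isMinimal m | occ-mins m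
  ... | true  | _ = refl
  ... | false | o = ⊥-elim (<-irrefl (sym o) m∈)

  min-ends-block : ∀ {m} → 0 < occ m mins → EndsWith (block m) m
  min-ends-block m∈ = cycle-minimal⇒last (block-cycle _) _ (in-own-block (min⇒< m∈)) (min⇒isMinimal m∈)

  cycleWord-min : ∀ {m} → 0 < occ m mins → cycleWord m ≡ block m
  cycleWord-min m∈ = cycle-last⇒cycleWord (block-cycle _) _ (min-ends-block m∈)

  mins-sorted : AllPairs _<_ mins
  mins-sorted = AllPairs-filterᵇ isMinimal (upTo n) (AllPairs.applyUpTo⁺₁ (λ i → i) n (λ i<j _ → i<j))

  k : ℕ
  k = length ws₀

  k≡ : k ≡ length mins
  k≡ = length-map cycleWord mins

  k≤n : k ≤ n
  k≤n = subst (_≤ n) (sym k≡) (subst (length mins ≤_) (length-upTo n) (length-filterᵇ isMinimal (upTo n)))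

  μ : ℕ → ℕ
  μ = nth mins

  μ∈mins : ∀ {a} → a < k → 0 < occ (μ a) mins
  μ∈mins a<k = occ-nth mins _ (subst (_ <_) k≡ a<k)

  slot₀ : ∀ {a} → a < k → slot ws₀ a ≡ block (μ a)
  slot₀ a<k = trans (slot-map-nth cycleWord mins _ (subst (_ <_) k≡ a<k)) (cycleWord-min (μ∈mins a<k))

  a≤μ : ∀ {a} → a < k → a ≤ μ a
  a≤μ {a} a<k = subst (_≤ μ a) (+-identityʳ a)
    (nth-≥ mins 0 a mins-sorted (All.universal (λ _ → z≤n) mins) (subst (a <_) k≡ a<k))

  slot₀-ends : ∀ {a} → a < k → EndsWith (slot ws₀ a) (μ a)
  slot₀-ends a<k = subst (λ v → EndsWith v _) (sym (slot₀ a<k)) (min-ends-block (μ∈mins a<k))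

  slot₀-decreasing : ∀ a → Linked _>_ (slot ws₀ a)
  slot₀-decreasing a with a <? k
  ... | yes a<k = subst (Linked _>_) (sym (slot₀ a<k)) (IsDecreasingCycle.decreasing (block-cycle _))
  ... | no  a≮k rewrite slot-beyond ws₀ a (≮⇒≥ a≮k) = []

  slot₀-above-μ : ∀ {a} → a < k → All (μ a ≤_) (slot ws₀ a)
  slot₀-above-μ {a} a<k = Linked>-EndsWith⇒All≥ (slot ws₀ a) (μ a) (slot₀-decreasing a) (slot₀-ends a<k)

  -- x lies in the cycle word of the minimum m iff m is the last letter μx of x's block.
  occ-cycleWord : ∀ {x μx} → x < n → EndsWith (block x) μx → ∀ m → 0 < occ m mins →
    occ x (cycleWord m) ≡ occ μx (m ∷ [])
  occ-cycleWord x<n ends m m∈ = trans (cong (occ _) (cycleWord-min m∈)) (occ-block-min x<n ends m m∈)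
    where
    occ-block-min : ∀ {x μx} → x < n → EndsWith (block x) μx → ∀ m → 0 < occ m mins → occ x (block m) ≡ occ μx (m ∷ [])
    occ-block-min {x} {μx} x<n ends m m∈ with m ≟ μx
    ... | yes refl rewrite occ-here m [] | block-of-member (EndsWith-occ ends) =
      ≤-antisym (subst (occ x (block x) ≤_) (once-P x<n) (occ-slot≤occ-concat x P _)) (in-own-block x<n)
    ... | no  m≢μx rewrite ≢⇒≡ᵇ-false m μx m≢μx with occ x (block m) in x∈m
    ...   | zero  = refl
    ...   | suc _ = ⊥-elim (m≢μx (EndsWith-unique
      (subst (λ c → EndsWith (slot P c) m) (sym (block-of-member (subst (0 <_) (sym x∈m) z<s))) (min-ends-block m∈))
      ends))

  letters₀ : ∀ x → occ x (concat ws₀) ≡ χ n x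
  letters₀ x with x <? n
  ... | no  x≮n = trans (occ-concat-map-0 x cycleWord mins (tabulate-occ mins λ m m∈ →
      trans (cong (occ x) (cycleWord-min m∈))
            (n≤0⇒n≡0 (subst (occ x (block m) ≤_) (trans (occ-P x) (χ-≮ x≮n)) (occ-slot≤occ-concat x P _)))))
    (sym (χ-≮ x≮n))
  ... | yes x<n with block x in block≡ | in-own-block x<n
  ...   | [] | ()
  ...   | b₀ ∷ rest | _ with EndsWith-nonempty b₀ rest
  ...     | μx , ends′ = begin
    occ x (concat ws₀)                   ≡⟨ occ-concat-map-≡ x μx cycleWord mins (tabulate-occ mins (occ-cycleWord x<n ends)) ⟩
    occ μx mins                          ≡⟨ occ-mins μx ⟩
    (if isMinimal μx then χ n μx else 0) ≡⟨ cong (λ b → if b then χ n μx else 0) μx-minimal ⟩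
    χ n μx                               ≡⟨ χ-< (in-block⇒< (EndsWith-occ ends)) ⟩
    1                                    ≡⟨ sym (χ-< x<n) ⟩
    χ n x                                ∎
    where
    open ≡-Reasoning
    ends : EndsWith (block x) μx
    ends = subst (λ v → EndsWith v μx) (sym block≡) ends′
    μx-minimal : isMinimal μx ≡ true
    μx-minimal = cycle-last⇒minimal (block-cycle _) μx
      (subst (λ c → EndsWith (slot P c) μx) (sym (block-of-member (EndsWith-occ ends))) ends)

  r : ℕ → ℕ
  r x = slotOf x ws₀

  once₀ : ∀ {x} → x < n → occ x (concat ws₀) ≡ 1
  once₀ x<n = trans (letters₀ _) (χ-< x<n)

  in-slot₀⇒< : ∀ {a x} → 0 < occ x (slot ws₀ a) → x < n
  in-slot₀⇒< {a} {x} x∈ = χ-pos⇒< (subst (0 <_) (letters₀ x) (≤-trans x∈ (occ-slot≤occ-concat x ws₀ a)))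

  r-spec : ∀ {x} → x < n → 0 < occ x (slot ws₀ (r x)) × r x < k
  r-spec x<n = slotOf-spec _ ws₀ (subst (0 <_) (sym (once₀ x<n)) z<s)

  r-unique : ∀ {a x} → 0 < occ x (slot ws₀ a) → r x ≡ a
  r-unique {a} {x} x∈ = occ-once⇒one-slot x ws₀ (r x) a (once₀ (in-slot₀⇒< x∈)) (proj₁ (r-spec (in-slot₀⇒< x∈))) x∈

  J₀ : ℕ
  J₀ = k ∸ 1

  slot-above₀ : ∀ a → All (a ≤_) (slot ws₀ a)
  slot-above₀ a with a <? k
  ... | yes a<k = All.map (≤-trans (a≤μ a<k)) (slot₀-above-μ a<k)
  ... | no  a≮k rewrite slot-beyond ws₀ a (≮⇒≥ a≮k) = []

  ends-with-own₀ : ∀ a → 0 < occ a (slot ws₀ a) → EndsWith (slot ws₀ a) a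
  ends-with-own₀ a a∈ = subst (EndsWith (slot ws₀ a)) (sym a≡μa) (slot₀-ends a<k)
    where
    a<k = occupied-slot-< ws₀ a a a∈
    a≡μa = ≤-antisym (a≤μ a<k) (lookup-occ (slot₀-above-μ a<k) a a∈)

  invariant₀ : βLoop.Invariant n r J₀ ws₀
  invariant₀ = record
    { bounded       = bounded
    ; letters       = letters₀
    ; slot-above    = slot-above₀
    ; ends-with-own = ends-with-own₀
    ; labels        = λ a → NearestSmaller-decreasing r a (slot ws₀ a) [] (slot₀-decreasing a) [] (λ _ → r-unique)
    ; complete      = λ a x _ rx≡a x<n → subst (λ c → 0 < occ x (slot ws₀ c)) rx≡a (proj₁ (r-spec x<n))
    ; pending       = λ a J₀<a empty → ⊥-elim (empty (slot-beyond ws₀ a (k≤a J₀<a)))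
    }
    where
    bounded : J₀ ≡ 0 ⊎ J₀ < n
    bounded with k | k≤n
    ... | zero  | _   = inj₁ refl
    ... | suc _ | k≤n = inj₂ k≤n
    k≤a : ∀ {a} → J₀ < a → k ≤ a
    k≤a J₀<a with k
    ... | zero  = z≤n
    ... | suc _ = J₀<a

  r-0 : 0 < n → r 0 ≡ 0
  r-0 0<n = n≤0⇒n≡0 (lookup-occ (slot-above₀ (r 0)) 0 (proj₁ (r-spec 0<n)))

  r-downward-closed : ∀ i b m → i < n → b ≤ i → m ≤ r b → Σ ℕ λ c → (c ≤ i) × (r c ≡ m)
  r-downward-closed i b m i<n b≤i m≤rb = μ m , μm≤i , r-unique (EndsWith-occ (slot₀-ends m<k))
    where
    b-spec = r-spec (≤-<-trans b≤i i<n)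
    m<k = ≤-<-trans m≤rb (proj₂ b-spec)
    μm≤i : μ m ≤ i
    μm≤i = ≤-trans (nth-mono mins m (r b) mins-sorted m≤rb (subst (r b <_) k≡ (proj₂ b-spec)))
             (≤-trans (lookup-occ (slot₀-above-μ (proj₂ b-spec)) b (proj₁ b-spec)) b≤i)

  β-inBP₂ : InBP₂ n (β σ₁)
  β-inBP₂ = InomCode.inBP₂ n r (βloop J₀ ws₀) (βLoop.βloop-preserves n r J₀ ws₀ invariant₀) r-0 r-downward-closed

mainTheorem10 : (n : ℕ) (σ₁ : Permutation′ n) → BP₁ n σ₁ → InBP₂ n (β σ₁)
mainTheorem10 n σ₁ (P , (_ , decreasing , partition) , σ₁≡) = InitialWords.β-inBP₂ n σ₁ P decreasing partition σ₁≡
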